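{- Let $A$ be a $2$-pole with $t(A)=(a+2,\,a,\,n)$ for some integers $a,n$. Let $A'$ be the $2$-pole constructed from $A$ as follows: take two disjoint copies of $A$ and new vertices $x_1,x_2,y_1,y_2$; in each copy of $A$, attach one of its two dangling edges to $x_1$ and the other to $x_2$ (so each becomes an ordinary edge ending at $x_1$ resp. $x_2$); add the edges $x_1y_1$, $y_1y_2$, $y_2x_2$; and add one dangling edge incident to $y_1$ and one dangling edge incident to $y_2$ (these two are the dangling edges of $A'$). Then $$t(A')=(2a+4,\;2a+2,\;2n+4).$$
   Context: A cubic $2$-pole is the structure obtained from a $2$-edge-connected cubic graph $G$ (parallel edges allowed) by cutting one edge $e=uv$ into two dangling edges, one incident to $u$ and one incident to $v$ (each dangling edge has only one endvertex). Every vertex of a $2$-pole thus has degree $3$, counting dangling edges. An even factor of a $2$-pole $P$ is a set $F$ of edges of $P$ (ordinary and dangling) such that every vertex of $P$ is incident to $0$ or $2$ edges of $F$, and $F$ contains either both dangling edges or neither (these correspond to the even factors of $G$, with $e$ replaced by both dangling edges). The components of such an $F$ (viewed together with all vertices of $P$) are isolated vertices, circuits, and, if $F$ contains the dangling edges, one path starting and ending with a dangling edge. The excess $q(P,F)$ is $2c+v$, where $c$ is the number of circuits of $F$ (the path through the dangling edges, if any, is not counted) and $v$ is the number of vertices of $P$ incident to no edge of $F$. The triple $t(P)=(q_0(P),q_2(P),n(P))$ is defined by: $q_0(P)$ is the minimum of $q(P,F)$ over even factors $F$ containing no dangling edge, $q_2(P)$ is the minimum of $q(P,F)$ over even factors $F$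 containing both dangling edges, and $n(P)$ is the number of vertices of $P$. -}

module Defs where

open import Data.Bool using (Bool; true; false; _∧_; _∨_; not; if_then_else_; T)
open import Data.Nat using (ℕ; zero; suc; _+_; _*_; _≤_)
open import Data.Fin using (Fin; zero; suc; _↑ˡ_; _↑ʳ_; splitAt; _<?_)
open import Data.Fin.Properties using (_≟_)
open import Data.Sum using (_⊎_; inj₁; inj₂; [_,_]′)
open import Data.Product using (Σ; _×_; _,_; ∃)
open import Data.Maybe using (Maybe; just; nothing)
open import Relation.Nullary.Decidable using (⌊_⌋)
open import Relation.Binary.PropositionalEquality using (_≡_; _≢_)

countF : ∀ {k} → (Fin k → Bool) → ℕ
countF {zero}  f = 0
countF {suc k} f = (if f zero then 1 else 0) + countF (λ i → f (suc i))

anyF : ∀ {k} → (Fin k → Bool) → Bool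
anyF {zero}  f = false
anyF {suc k} f = f zero ∨ anyF (λ i → f (suc i))

_==_ : ∀ {k} → Fin k → Fin k → Bool
i == j = ⌊ i ≟ j ⌋

-- Raw 2-pole: vertices Fin n, ordinary edges Fin m (edge e joins end₁ e
-- and end₂ e; parallel edges allowed), and two dangling edges whose
-- (only) endvertices are dang₁ and dang₂.

record Pole : Set where
  field
    n     : ℕ
    m     : ℕ
    end₁  : Fin m → Fin n
    end₂  : Fin m → Fin n
    dang₁ : Fin n
    dang₂ : Fin n

open Pole public

[_] : Bool → ℕ
[ b ] = if b then 1 else 0

-- degree of a vertex (dangling edges counted once, a loop would count twice)
degree : (P : Pole) → Fin (n P) → ℕ
degree P v =
  countF (λ e → end₁ P e == v) + countF (λ e → end₂ P e == v)
  + [ dang₁ P == v ] + [ dang₂ P == v ]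

-- The cubic graph G: ordinary edges plus the edge e = dang₁ dang₂
-- (rejoining the two dangling edges), indexed by Maybe (Fin m).
gEnd₁ gEnd₂ : (P : Pole) → Maybe (Fin (m P)) → Fin (n P)
gEnd₁ P (just e) = end₁ P e
gEnd₁ P nothing  = dang₁ P
gEnd₂ P (just e) = end₂ P e
gEnd₂ P nothing  = dang₂ P

data Reach (P : Pole) (ok : Maybe (Fin (m P)) → Set) : Fin (n P) → Fin (n P) → Set where
  here : ∀ {u} → Reach P ok u u
  fwd  : ∀ {w} e → ok e → Reach P ok (gEnd₂ P e) w → Reach P ok (gEnd₁ P e) w
  bwd  : ∀ {w} e → ok e → Reach P ok (gEnd₁ P e) w → Reach P ok (gEnd₂ P e) w

-- G is 2-edge-connected: removing any single edge leaves G connected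
-- (this includes connectivity of G, as G has at least one edge).
TwoEdgeConnected : Pole → Set
TwoEdgeConnected P = ∀ (e : Maybe (Fin (m P))) (u v : Fin (n P)) → Reach P (λ f → f ≢ e) u v

Is2Pole : Pole → Set
Is2Pole P = (∀ v → degree P v ≡ 3) × TwoEdgeConnected P

-- Even factors.  A factor is a set of ordinary edges (inF) together with
-- a flag saying whether both dangling edges are included.

record Factor (P : Pole) : Set where
  field
    inF   : Fin (m P) → Bool
    withD : Bool

open Factor public

degF : (P : Pole) → Factor P → Fin (n P) → ℕ
degF P F v =
  countF (λ e → inF F e ∧ (end₁ P e == v)) + countF (λ e → inF F e ∧ (end₂ P e == v))
  + (if withD F then [ dang₁ P == v ] + [ dang₂ P == v ] else 0)

IsEven : (P : Pole) → Factor P → Set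
IsEven P F = ∀ v → degF P F v ≡ 0 ⊎ degF P F v ≡ 2

adjF : (P : Pole) → Factor P → Fin (n P) → Fin (n P) → Bool
adjF P F u w = anyF (λ e → inF F e ∧ (((end₁ P e == u) ∧ (end₂ P e == w)) ∨ ((end₁ P e == w) ∧ (end₂ P e == u))))

reachF : (P : Pole) → Factor P → ℕ → Fin (n P) → Fin (n P) → Bool
reachF P F zero    u w = u == w
reachF P F (suc k) u w = reachF P F k u w ∨ anyF (λ x → reachF P F k u x ∧ adjF P F x w)

-- same component of F (walks of length ≤ n suffice)
connF : (P : Pole) → Factor P → Fin (n P) → Fin (n P) → Bool
connF P F = reachF P F (n P)

isZero : ℕ → Bool
isZero zero    = true
isZero (suc _) = false

uncovered : (P : Pole) → Factor P → Fin (n P) → Bool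
uncovered P F u = isZero (degF P F u)

onPath : (P : Pole) → Factor P → Fin (n P) → Bool
onPath P F u = withD F ∧ connF P F (dang₁ P) u

-- u is the least-indexed vertex of a circuit of F
circuitRep : (P : Pole) → Factor P → Fin (n P) → Bool
circuitRep P F u =
  not (uncovered P F u) ∧ not (onPath P F u)
  ∧ not (anyF (λ w → ⌊ w <? u ⌋ ∧ connF P F u w))

circuits : (P : Pole) → Factor P → ℕ
circuits P F = countF (circuitRep P F)

isolated : (P : Pole) → Factor P → ℕ
isolated P F = countF (uncovered P F)

excess : (P : Pole) → Factor P → ℕ
excess P F = 2 * circuits P F + isolated P F

IsMinExcess : (P : Pole) → Bool → ℕ → Set
IsMinExcess P b k =
  (Σ (Factor P) λ F → IsEven P F × withD F ≡ b × excess P F ≡ k)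
  × (∀ (F : Factor P) → IsEven P F → withD F ≡ b → k ≤ excess P F)

HasTriple : Pole → ℕ → ℕ → ℕ → Set
HasTriple P q0 q2 N = IsMinExcess P false q0 × IsMinExcess P true q2 × n P ≡ N

-- Vertices: copy 1 (Fin n), copy 2 (Fin n), then x₁ x₂ y₁ y₂.
-- Edges: copy 1 (Fin m), copy 2 (Fin m), then 7 new edges:
--   0: c₁(a₁)–x₁  1: c₁(b₁)–x₂  2: c₂(a₂)–x₁  3: c₂(b₂)–x₂
--   4: x₁–y₁      5: y₁–y₂      6: y₂–x₂
-- where in copy i, (aᵢ , bᵢ) is (dang₁ , dang₂) if flipᵢ = false and
-- (dang₂ , dang₁) if flipᵢ = true (which dangling edge goes to x₁).

module Construction (A : Pole) (flip₁ flip₂ : Bool) where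
  N M : ℕ
  N = n A + n A + 4
  M = m A + m A + 7

  c₁ c₂ : Fin (n A) → Fin N
  c₁ i = (i ↑ˡ n A) ↑ˡ 4
  c₂ i = (n A ↑ʳ i) ↑ˡ 4

  new : Fin 4 → Fin N
  new j = (n A + n A) ↑ʳ j

  x₁ x₂ y₁ y₂ : Fin N
  x₁ = new zero
  x₂ = new (suc zero)
  y₁ = new (suc (suc zero))
  y₂ = new (suc (suc (suc zero)))

  toX₁ toX₂ : Bool → Fin (n A)
  toX₁ false = dang₁ A
  toX₁ true  = dang₂ A
  toX₂ false = dang₂ A
  toX₂ true  = dang₁ A

  newEnd₁ newEnd₂ : Fin 7 → Fin N
  newEnd₁ zero = c₁ (toX₁ flip₁)
  newEnd₁ (suc zero) = c₁ (toX₂ flip₁)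
  newEnd₁ (suc (suc zero)) = c₂ (toX₁ flip₂)
  newEnd₁ (suc (suc (suc zero))) = c₂ (toX₂ flip₂)
  newEnd₁ (suc (suc (suc (suc zero)))) = x₁
  newEnd₁ (suc (suc (suc (suc (suc zero))))) = y₁
  newEnd₁ (suc (suc (suc (suc (suc (suc zero)))))) = y₂
  newEnd₂ zero = x₁
  newEnd₂ (suc zero) = x₂
  newEnd₂ (suc (suc zero)) = x₁
  newEnd₂ (suc (suc (suc zero))) = x₂
  newEnd₂ (suc (suc (suc (suc zero)))) = y₁
  newEnd₂ (suc (suc (suc (suc (suc zero))))) = y₂
  newEnd₂ (suc (suc (suc (suc (suc (suc zero)))))) = x₂

  ends : (Fin (m A) → Fin (n A)) → (Fin 7 → Fin N) → Fin M → Fin N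
  ends f g e = [ [ (λ i → c₁ (f i)) , (λ i → c₂ (f i)) ]′ ∘s splitAt (m A) , g ]′ (splitAt (m A + m A) e)
    where
      _∘s_ : ∀ {X Y Z : Set} → (Y → Z) → (X → Y) → X → Z
      (h ∘s k) x = h (k x)

  A' : Pole
  A' = record
    { n = N ; m = M
    ; end₁ = ends (end₁ A) newEnd₁
    ; end₂ = ends (end₂ A) newEnd₂
    ; dang₁ = y₁ ; dang₂ = y₂ }

doubled : (A : Pole) (flip₁ flip₂ : Bool) → Pole
doubled A f₁ f₂ = Construction.A' A f₁ f₂

module Submission where

-- Every component of an even factor F is an isolated vertex, a circuit or the
-- path through the dangling edges, so  excess + isolated + 2·[path] = 2·#components.
-- Given an even factor F' of A', its restrictions F₁, F₂ to the two copies of A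
-- (taking the dangling edges of copy i to be used iff its edge to x₁ is) are even
-- factors of A: a handshake parity argument shows that both edges joining a copy
-- to x₁, x₂ are used or neither is.  The components of F' are those of F₁ and F₂,
-- except that the two dangling paths and x₁ x₂ y₁ y₂ are glued along a 6-vertex
-- quotient graph.  This yields an exact identity between excess(F') and
-- excess(F₁) + excess(F₂) whose correction terms depend only on the seven new
-- edges used and on the dangling edges of A'; the hypothesis
-- excess(F) ≥ a + (0 or 2) on A and a finite check over these parameters give
-- the lower bounds 2a + 4 and 2a + 2, and two factors glued from optimal factors
-- of A attain them.

open import Defs
open import Data.Bool using (Bool; true; false; _∧_; _∨_; not; if_then_else_; T)
open import Data.Bool.Properties using (∨-comm; ∨-assoc; ∧-comm; ∧-zeroʳ; ∧-identityʳ; ∧-commutativeMonoid)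
import Algebra.Solver.CommutativeMonoid as CommutativeMonoidSolver
open import Data.Nat using (ℕ; zero; suc; _+_; _*_; _≤_; _<_; _≤ᵇ_; z≤n; s≤s)
open import Data.Nat.Properties using (≤-refl; ≤-trans; +-mono-≤; +-suc; +-comm; +-assoc; m≤n⇒m≤1+n; ≤-reflexive; ≤-pred; +-identityʳ; suc-injective; <-irrefl; m≤m+n; <⇒≱; <⇒≤; +-monoʳ-<; m≤n⇒m≤n+o; +-cancelˡ-<; +-cancelʳ-≡; module ≤-Reasoning; +-cancelʳ-≤; ≤ᵇ⇒≤; +-monoˡ-≤; 1+n≰n)
open import Data.Nat.Solver using (module +-*-Solver)
open +-*-Solver using (solve; _:+_; _:*_; _:=_; con)
open import Data.Fin using (Fin; zero; suc; _↑ˡ_; _↑ʳ_; splitAt; _<?_; toℕ)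
open import Data.Fin.Properties using (_≟_)
import Data.Fin as Fin
import Data.Fin.Properties as FP
open import Data.Sum using (_⊎_; inj₁; inj₂; [_,_]′)
open import Data.Product using (Σ; _×_; _,_; ∃; proj₁; proj₂)
open import Data.Empty using (⊥; ⊥-elim)
open CommutativeMonoidSolver ∧-commutativeMonoid using (prove; var; _⊕_)
open import Data.Unit using (tt)
open import Data.Vec using (Vec; []; _∷_; tabulate; lookup)
open import Data.Vec.Properties using (lookup∘tabulate; tabulate-cong)
open import Relation.Binary.PropositionalEquality hiding ([_])
open import Relation.Nullary using (¬_; Dec; yes; no)
open import Relation.Nullary.Decidable using (⌊_⌋; toWitness; fromWitness)

∧-el : ∀ {a b} → T (a ∧ b) → T a
∧-el {true} t = tt
∧-er : ∀ {a b} → T (a ∧ b) → T b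
∧-er {true} t = t
∧-i : ∀ {a b} → T a → T b → T (a ∧ b)
∧-i {true} _ t = t
∨-e : ∀ {a b} → T (a ∨ b) → T a ⊎ T b
∨-e {true} t = inj₁ tt
∨-e {false} t = inj₂ t
∨-il : ∀ {a b} → T a → T (a ∨ b)
∨-il {true} _ = tt
∨-ir : ∀ {a b} → T b → T (a ∨ b)
∨-ir {true} _ = tt
∨-ir {false} t = t
T-≡ : ∀ {a} → T a → a ≡ true
T-≡ {true} _ = refl
≡-T : ∀ {a} → a ≡ true → T a
≡-T refl = tt
F-≡ : ∀ {a} → ¬ T a → a ≡ false
F-≡ {true} f = ⊥-elim (f tt)
F-≡ {false} _ = refl
not-T : ∀ {a} → ¬ T a → T (not a)
not-T {true} f = f tt
not-T {false} _ = tt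
T-not : ∀ {a} → T (not a) → ¬ T a
T-not {true} () _
T-not {false} _ ()
T-sub : ∀ {a b} → a ≡ b → T a → T b
T-sub refl t = t

T-dec : (b : Bool) → T b ⊎ ¬ T b
T-dec true = inj₁ tt
T-dec false = inj₂ (λ ())

∧-rotate : ∀ a b c → (a ∧ b ∧ c) ≡ (c ∧ b ∧ a)
∧-rotate a b c = prove 3 (x ⊕ (y ⊕ z)) (z ⊕ (y ⊕ x)) (a ∷ b ∷ c ∷ [])
  where x = var zero
        y = var (suc zero)
        z = var (suc (suc zero))

∧-shuffle : ∀ l b p c → (l ∧ ((b ∧ p) ∧ c)) ≡ ((b ∧ c) ∧ (p ∧ l))
∧-shuffle l b p c = prove 4 (x ⊕ ((y ⊕ z) ⊕ w)) ((y ⊕ w) ⊕ (z ⊕ x)) (l ∷ b ∷ p ∷ c ∷ [])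
  where x = var zero
        y = var (suc zero)
        z = var (suc (suc zero))
        w = var (suc (suc (suc zero)))

T-ext : ∀ {a b} → (T a → T b) → (T b → T a) → a ≡ b
T-ext {true} {true} f g = refl
T-ext {true} {false} f g = ⊥-elim (f tt)
T-ext {false} {true} f g = ⊥-elim (g tt)
T-ext {false} {false} f g = refl

allVec : (k : ℕ) → (Vec Bool k → Bool) → Bool
allVec zero    p = p []
allVec (suc k) p = allVec k (λ v → p (true ∷ v)) ∧ allVec k (λ v → p (false ∷ v))

allVec-sound : ∀ k p → T (allVec k p) → ∀ v → T (p v)
allVec-sound zero    p t [] = t
allVec-sound (suc k) p t (true ∷ v)  = allVec-sound k (λ w → p (true ∷ w)) (∧-el t) v
allVec-sound (suc k) p t (false ∷ v) = allVec-sound k (λ w → p (false ∷ w)) (∧-er {allVec k (λ w → p (true ∷ w))} t) v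

isYes-false : ∀ {P : Set} (d : Dec P) → ¬ P → ⌊ d ⌋ ≡ false
isYes-false (yes p) ne = ⊥-elim (ne p)
isYes-false (no _) ne = refl

==-sound : ∀ {k} {i j : Fin k} → T (i == j) → i ≡ j
==-sound t = toWitness t
==-refl : ∀ {k} (i : Fin k) → T (i == i)
==-refl i = fromWitness refl
==-false : ∀ {k} {i j : Fin k} → i ≢ j → (i == j) ≡ false
==-false {i = i} {j} ne = isYes-false (i ≟ j) ne


countF-ext : ∀ {k} {f g : Fin k → Bool} → (∀ i → f i ≡ g i) → countF f ≡ countF g
countF-ext {zero} e = refl
countF-ext {suc k} e = cong₂ (λ a b → [ a ] + b) (e zero) (countF-ext (λ i → e (suc i)))

anyF-ext : ∀ {k} {f g : Fin k → Bool} → (∀ i → f i ≡ g i) → anyF f ≡ anyF g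
anyF-ext {zero} e = refl
anyF-ext {suc k} e = cong₂ _∨_ (e zero) (anyF-ext (λ i → e (suc i)))

anyF-intro : ∀ {k} (f : Fin k → Bool) (i : Fin k) → T (f i) → T (anyF f)
anyF-intro f zero t = ∨-il t
anyF-intro {suc k} f (suc i) t = ∨-ir {f zero} (anyF-intro (λ j → f (suc j)) i t)

anyF-elim : ∀ {k} (f : Fin k → Bool) → T (anyF f) → ∃ λ i → T (f i)
anyF-elim {zero} f ()
anyF-elim {suc k} f t with ∨-e {f zero} t
... | inj₁ t' = zero , t'
... | inj₂ t' with anyF-elim (λ j → f (suc j)) t'
... | i , ti = suc i , ti

anyF-false : ∀ {k} (f : Fin k → Bool) → (∀ i → ¬ T (f i)) → anyF f ≡ false
anyF-false f h = F-≡ (λ t → let (i , ti) = anyF-elim f t in h i ti)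

countF-zero : ∀ {k} (f : Fin k → Bool) → (∀ i → ¬ T (f i)) → countF f ≡ 0
countF-zero {zero} f h = refl
countF-zero {suc k} f h rewrite F-≡ (h zero) = countF-zero (λ i → f (suc i)) (λ i → h (suc i))

countF-allFalse : ∀ {k} (f : Fin k → Bool) → (∀ i → f i ≡ false) → countF f ≡ 0
countF-allFalse f h = countF-zero f (λ i t → subst T (h i) t)

anyF-allFalse : ∀ {k} (f : Fin k → Bool) → (∀ i → f i ≡ false) → anyF f ≡ false
anyF-allFalse f h = anyF-false f (λ i t → subst T (h i) t)

countF-≤ : ∀ {k} (f : Fin k → Bool) → countF f ≤ k
countF-≤ {zero} f = z≤n
countF-≤ {suc k} f with f zero
... | true = s≤s (countF-≤ (λ i → f (suc i)))
... | false = m≤n⇒m≤1+n (countF-≤ (λ i → f (suc i)))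

[]-mono : ∀ {a b} → (T a → T b) → [ a ] ≤ [ b ]
[]-mono {true} {true} h = ≤-refl
[]-mono {true} {false} h = ⊥-elim (h tt)
[]-mono {false} h = z≤n

countF-mono : ∀ {k} (f g : Fin k → Bool) → (∀ i → T (f i) → T (g i)) → countF f ≤ countF g
countF-mono {zero} f g h = z≤n
countF-mono {suc k} f g h = +-mono-≤ ([]-mono (h zero)) (countF-mono (λ i → f (suc i)) (λ i → g (suc i)) (λ i → h (suc i)))

countF-strict : ∀ {k} (f g : Fin k → Bool) → (∀ i → T (f i) → T (g i)) →
  (i : Fin k) → T (g i) → ¬ T (f i) → suc (countF f) ≤ countF g
countF-strict {suc k} f g h zero tg nf rewrite F-≡ nf | T-≡ tg =
  s≤s (countF-mono (λ i → f (suc i)) (λ i → g (suc i)) (λ i → h (suc i)))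
countF-strict {suc k} f g h (suc i) tg nf =
  ≤-trans (≤-reflexive (sym (+-suc [ f zero ] _)))
   (+-mono-≤ ([]-mono (h zero)) (countF-strict (λ i → f (suc i)) (λ i → g (suc i)) (λ i → h (suc i)) i tg nf))

countF-split : ∀ p q (f : Fin (p + q) → Bool) →
  countF f ≡ countF (λ i → f (i ↑ˡ q)) + countF (λ j → f (p ↑ʳ j))
countF-split zero q f = refl
countF-split (suc p) q f = trans (cong ([ f zero ] +_) (countF-split p q (λ i → f (suc i))))
  (sym (+-assoc [ f zero ] _ _))

anyF-split : ∀ p q (f : Fin (p + q) → Bool) →
  anyF f ≡ (anyF (λ i → f (i ↑ˡ q)) ∨ anyF (λ j → f (p ↑ʳ j)))
anyF-split zero q f = refl
anyF-split (suc p) q f = trans (cong (f zero ∨_) (anyF-split p q (λ i → f (suc i))))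
  (sym (∨-assoc (f zero) _ _))


lt-zero : ∀ {k} (w : Fin (suc k)) → ⌊ w <? (zero {k}) ⌋ ≡ false
lt-zero {k} w = isYes-false (w <? zero {k}) (λ ())
lt-z-s : ∀ {k} (u : Fin k) → ⌊ (zero {k}) <? suc u ⌋ ≡ true
lt-z-s {k} u = T-≡ (fromWitness {a? = zero {k} <? suc u} (s≤s z≤n))
lt-s-s : ∀ {k} (w u : Fin k) → ⌊ suc w <? suc u ⌋ ≡ ⌊ w <? u ⌋
lt-s-s w u = T-ext (λ t → fromWitness (≤-pred (toWitness t))) (λ t → fromWitness (s≤s (toWitness t)))

count-pos : ∀ {k} (f : Fin k → Bool) (i : Fin k) → T (f i) → 1 ≤ countF f
count-pos {k} f i t = ≤-trans (≤-reflexive (cong suc (sym (countF-zero {k} (λ _ → false) (λ _ ())))))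
   (countF-strict {k} (λ _ → false) f (λ _ ()) i t (λ ()))

minCount : ∀ {k} (S : Fin k → Bool) (i : Fin k) → T (S i) →
  countF (λ u → S u ∧ not (anyF (λ w → ⌊ w <? u ⌋ ∧ S w))) ≡ 1
minCount {suc k} S i t = go (S zero) refl i t
  where
  g0 : (S zero ∧ not (anyF (λ w → ⌊ w <? (zero {k}) ⌋ ∧ S w))) ≡ S zero
  g0 rewrite anyF-ext {f = λ w → ⌊ w <? (zero {k}) ⌋ ∧ S w} {g = λ _ → false} (λ w → cong (_∧ S w) (lt-zero w))
           | anyF-false {suc k} (λ _ → false) (λ _ ()) with S zero
  ... | true = refl
  ... | false = refl
  gs : ∀ u → (anyF (λ w → ⌊ w <? suc u ⌋ ∧ S w)) ≡ (S zero ∨ anyF (λ w → ⌊ w <? u ⌋ ∧ S (suc w)))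
  gs u = cong₂ _∨_ (cong (_∧ S zero) (lt-z-s u)) (anyF-ext (λ w → cong (_∧ S (suc w)) (lt-s-s w u)))
  go : ∀ b → S zero ≡ b → (i : Fin (suc k)) → T (S i) → countF (λ u → S u ∧ not (anyF (λ w → ⌊ w <? u ⌋ ∧ S w))) ≡ 1
  go true e _ _ = trans (cong₂ _+_ (cong [_] (trans g0 e))
     (countF-zero _ (λ u tu → T-not (∧-er {S (suc u)} tu) (T-sub (sym (gs u)) (∨-il {S zero} {anyF (λ w → ⌊ w <? u ⌋ ∧ S (suc w))} (≡-T e))))))
     refl
  go false e zero t = ⊥-elim (T-sub e t)
  go false e (suc i') t = trans (cong₂ _+_ (cong [_] (trans g0 e))
      (trans (countF-ext (λ u → cong (λ z → S (suc u) ∧ not z) (trans (gs u) (cong (_∨ anyF (λ w → ⌊ w <? u ⌋ ∧ S (suc w))) e))))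
        (minCount (λ w → S (suc w)) i' t)))
      refl

-- The bounded reachability test `reach j` (walks of length ≤ j) stabilises by
-- j = k, so `conn = reach k` decides the inductive reachability `Conn`.
module Graph {k : ℕ} (adj : Fin k → Fin k → Bool) where

  data Conn (u : Fin k) : Fin k → Set where
    here : Conn u u
    step : ∀ {x w} → Conn u x → T (adj x w) → Conn u w

  Conn-trans : ∀ {u x w} → Conn u x → Conn x w → Conn u w
  Conn-trans p here = p
  Conn-trans p (step q a) = step (Conn-trans p q) a

  Conn-1 : ∀ {u w} → T (adj u w) → Conn u w
  Conn-1 a = step here a

  reach : ℕ → Fin k → Fin k → Bool
  reach zero u w = u == w
  reach (suc j) u w = reach j u w ∨ anyF (λ x → reach j u x ∧ adj x w)

  reach⇒Conn : ∀ j {u w} → T (reach j u w) → Conn u w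
  reach⇒Conn zero {u} t with ==-sound {i = u} t
  ... | refl = here
  reach⇒Conn (suc j) {u} {w} t with ∨-e {reach j u w} t
  ... | inj₁ t' = reach⇒Conn j t'
  ... | inj₂ t' with anyF-elim _ t'
  ... | x , tx = step (reach⇒Conn j (∧-el tx)) (∧-er {reach j u x} tx)

  reach-refl : ∀ j u → T (reach j u u)
  reach-refl zero u = ==-refl u
  reach-refl (suc j) u = ∨-il (reach-refl j u)

  Stable : ℕ → Fin k → Set
  Stable j u = ∀ w → T (reach (suc j) u w) → T (reach j u w)

  stable-prop : ∀ j u → Stable j u → Stable (suc j) u
  stable-prop j u st w t with ∨-e {reach (suc j) u w} t
  ... | inj₁ t' = t'
  ... | inj₂ t' with anyF-elim _ t'
  ... | x , tx = ∨-ir {reach j u w} (anyF-intro _ x (∧-i (st x (∧-el tx)) (∧-er {reach (suc j) u x} tx)))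

  cnt : ℕ → Fin k → ℕ
  cnt j u = countF (reach j u)

  growsOrStable : ∀ j u → (suc j ≤ cnt j u) ⊎ Stable j u
  growsOrStable zero u = inj₁ (count-pos _ u (reach-refl zero u))
  growsOrStable (suc j) u with growsOrStable j u
  ... | inj₂ st = inj₂ (stable-prop j u st)
  ... | inj₁ le with T-dec (anyF (λ w → reach (suc j) u w ∧ not (reach j u w)))
  ... | inj₁ t = let (w , tw) = anyF-elim _ t in
        inj₁ (≤-trans (s≤s le) (countF-strict (reach j u) (reach (suc j) u) (λ w → ∨-il)
               w (∧-el tw) (T-not (∧-er {reach (suc j) u w} tw))))
  ... | inj₂ nt = inj₂ (stable-prop j u (λ w t → st' w t))
    where
    st' : Stable j u
    st' w t with T-dec (reach j u w)
    ... | inj₁ r = r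
    ... | inj₂ nr = ⊥-elim (nt (anyF-intro _ w (∧-i t (not-T nr))))

  stableK : ∀ u → Stable k u
  stableK u with growsOrStable k u
  ... | inj₂ st = st
  ... | inj₁ le = ⊥-elim (1+n≰n (≤-trans le (countF-≤ (reach k u))))

  Conn⇒reach : ∀ {u w} → Conn u w → T (reach k u w)
  Conn⇒reach {u} here = reach-refl k u
  Conn⇒reach {u} (step {x} {w} p a) =
    stableK u w (∨-ir {reach k u w} (anyF-intro _ x (∧-i (Conn⇒reach p) a)))

  conn : Fin k → Fin k → Bool
  conn = reach k

  key : ∀ {K : Set} (κ : Fin k → K) → (∀ u w → T (adj u w) → κ u ≡ κ w) →
    ∀ {u w} → Conn u w → κ u ≡ κ w
  key κ h here = refl
  key κ h (step p a) = trans (key κ h p) (h _ _ a)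

  module Sym (adj-sym : ∀ u w → T (adj u w) → T (adj w u)) where
    Conn-sym : ∀ {u w} → Conn u w → Conn w u
    Conn-sym here = here
    Conn-sym (step p a) = Conn-trans (Conn-1 (adj-sym _ _ a)) (Conn-sym p)

    conn-sym : ∀ u w → T (conn u w) → T (conn w u)
    conn-sym u w t = Conn⇒reach (Conn-sym (reach⇒Conn k t))

    conn-trans : ∀ u x w → T (conn u x) → T (conn x w) → T (conn u w)
    conn-trans u x w t s = Conn⇒reach (Conn-trans (reach⇒Conn k t) (reach⇒Conn k s))

    conn-row : ∀ u w → T (conn u w) → ∀ x → conn u x ≡ conn w x
    conn-row u w t x = T-ext (λ s → conn-trans w u x (conn-sym u w t) s) (λ s → conn-trans u w x t s)

    least : Fin k → Bool
    least u = not (anyF (λ w → ⌊ w <? u ⌋ ∧ conn u w))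

    leastInClass : ∀ a → countF (λ u → conn a u ∧ least u) ≡ 1
    leastInClass a = trans (countF-ext eq) (minCount (conn a) a (reach-refl k a))
      where
      eq : ∀ u → (conn a u ∧ least u) ≡ (conn a u ∧ not (anyF (λ w → ⌊ w <? u ⌋ ∧ conn a w)))
      eq u with T-dec (conn a u)
      ... | inj₂ n rewrite F-≡ n = refl
      ... | inj₁ t rewrite T-≡ t = cong (λ z → not z) (anyF-ext (λ w → cong (⌊ w <? u ⌋ ∧_) (conn-row u a (conn-sym a u t) w)))

liftConn : ∀ {k k'} (adj : Fin k → Fin k → Bool) (adj' : Fin k' → Fin k' → Bool) (f : Fin k → Fin k') →
    (∀ u w → T (adj u w) → Graph.Conn adj' (f u) (f w)) →
    ∀ {u w} → Graph.Conn adj u w → Graph.Conn adj' (f u) (f w)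
liftConn adj adj' f h Graph.here = Graph.here
liftConn adj adj' f h (Graph.step p a) = Graph.Conn-trans adj' (liftConn adj adj' f h p) (h _ _ a)


swap4 : ∀ a b c d → (a + b) + (c + d) ≡ (a + c) + (b + d)
swap4 a b c d = trans (+-assoc a b (c + d)) (trans (cong (a +_) (trans (sym (+-assoc b c d))
  (trans (cong (_+ d) (+-comm b c)) (+-assoc c b d)))) (sym (+-assoc a c (b + d))))

countF-part : ∀ {k} (f g : Fin k → Bool) →
  countF f ≡ countF (λ u → f u ∧ g u) + countF (λ u → f u ∧ not (g u))
countF-part {zero} f g = refl
countF-part {suc k} f g = trans (cong₂ _+_ (lem (f zero) (g zero)) (countF-part (λ u → f (suc u)) (λ u → g (suc u))))
  (swap4 [ f zero ∧ g zero ] [ f zero ∧ not (g zero) ] _ _)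
  where
  lem : ∀ a b → [ a ] ≡ [ a ∧ b ] + [ a ∧ not b ]
  lem true true = refl
  lem true false = refl
  lem false b = refl

isZero-+l : ∀ x y → T (isZero (x + y)) → T (isZero x)
isZero-+l zero y _ = tt
isZero-+r : ∀ x y → T (isZero (x + y)) → T (isZero y)
isZero-+r zero y t = t
isZero-pos : ∀ {x} → 1 ≤ x → ¬ T (isZero x)
isZero-pos {suc x} _ ()

module FactorGraph (P : Pole) (F : Factor P) where
  adj : Fin (n P) → Fin (n P) → Bool
  adj = adjF P F
  open Graph adj public

  adj≡ : ∀ u w → adj u w ≡ adj w u
  adj≡ u w = anyF-ext (λ e → cong (inF F e ∧_) (∨-comm ((end₁ P e == u) ∧ (end₂ P e == w)) ((end₁ P e == w) ∧ (end₂ P e == u))))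

  adj-sym : ∀ u w → T (adj u w) → T (adj w u)
  adj-sym u w t = T-sub (adj≡ u w) t

  open Sym adj-sym public

  reach≡ : ∀ j u w → reachF P F j u w ≡ reach j u w
  reach≡ zero u w = refl
  reach≡ (suc j) u w = cong₂ _∨_ (reach≡ j u w) (anyF-ext (λ x → cong (_∧ adj x w) (reach≡ j u x)))

  connF≡ : ∀ u w → connF P F u w ≡ conn u w
  connF≡ = reach≡ (n P)

  adj-intro : ∀ e → T (inF F e) → T (adj (end₁ P e) (end₂ P e))
  adj-intro e t = anyF-intro _ e (∧-i t (∨-il {(end₁ P e == end₁ P e) ∧ (end₂ P e == end₂ P e)} {(end₁ P e == end₂ P e) ∧ (end₂ P e == end₁ P e)} (∧-i {end₁ P e == end₁ P e} (==-refl (end₁ P e)) (==-refl (end₂ P e)))))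

  adj-elim : ∀ u w → T (adj u w) → Σ (Fin (m P)) λ e → T (inF F e) ×
     ((end₁ P e ≡ u × end₂ P e ≡ w) ⊎ (end₁ P e ≡ w × end₂ P e ≡ u))
  adj-elim u w t with anyF-elim _ t
  ... | e , te with ∨-e (∧-er {inF F e} te)
  ... | inj₁ x = e , ∧-el te , inj₁ (==-sound (∧-el x) , ==-sound (∧-er {end₁ P e == u} x))
  ... | inj₂ x = e , ∧-el te , inj₂ (==-sound (∧-el x) , ==-sound (∧-er {end₁ P e == w} x))

  keyConn : ∀ {K : Set} (κ : Fin (n P) → K) → (∀ e → T (inF F e) → κ (end₁ P e) ≡ κ (end₂ P e)) →
    ∀ {u w} → Conn u w → κ u ≡ κ w
  keyConn κ h = key κ (λ u w a → lem (adj-elim u w a))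
    where
    lem : ∀ {u w} → Σ (Fin (m P)) (λ e → T (inF F e) ×
            ((end₁ P e ≡ u × end₂ P e ≡ w) ⊎ (end₁ P e ≡ w × end₂ P e ≡ u))) → κ u ≡ κ w
    lem (e , t , inj₁ (refl , refl)) = h e t
    lem (e , t , inj₂ (refl , refl)) = sym (h e t)

  ordL ordR : Fin (n P) → ℕ
  ordL v = countF (λ e → inF F e ∧ (end₁ P e == v))
  ordR v = countF (λ e → inF F e ∧ (end₂ P e == v))

  unc-noadj : ∀ u w → T (uncovered P F u) → ¬ T (adj u w)
  unc-noadj u w tu ta with adj-elim u w ta
  ... | e , t , inj₁ (refl , _) = isZero-pos (count-pos _ e (∧-i t (==-refl _)))
        (isZero-+l (ordL u) (ordR u) (isZero-+l (ordL u + ordR u) _ tu))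
  ... | e , t , inj₂ (_ , refl) = isZero-pos (count-pos _ e (∧-i t (==-refl _)))
        (isZero-+r (ordL u) (ordR u) (isZero-+l (ordL u + ordR u) _ tu))

  unc-Conn : ∀ u x → T (uncovered P F u) → Conn u x → x ≡ u
  unc-Conn u x tu here = refl
  unc-Conn u x tu (step p a) with unc-Conn u _ tu p
  ... | refl = ⊥-elim (unc-noadj u x tu a)

  unc-least : ∀ u → T (uncovered P F u) → T (least u)
  unc-least u tu = not-T (λ t → let (w , tw) = anyF-elim _ t in
     lem w (∧-el tw) (unc-Conn u w tu (reach⇒Conn (n P) (∧-er {⌊ w <? u ⌋} tw))))
    where
    lem : ∀ w → T ⌊ w <? u ⌋ → w ≡ u → ⊥
    lem w t refl = <-irrefl refl (toWitness t)

  dpart : Fin (n P) → ℕ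
  dpart v = if withD F then [ dang₁ P == v ] + [ dang₂ P == v ] else 0

  dpart-pos : withD F ≡ true → ∀ u → dang₁ P ≡ u → 1 ≤ dpart u
  dpart-pos e u refl rewrite e | T-≡ (==-refl (dang₁ P)) = s≤s z≤n

  onPath-unc : ∀ u → T (onPath P F u) → ¬ T (uncovered P F u)
  onPath-unc u to tu =
    isZero-pos (dpart-pos (T-≡ (∧-el to)) u
      (unc-Conn u (dang₁ P) tu (Conn-sym (reach⇒Conn (n P) (T-sub (connF≡ _ _) (∧-er {withD F} to))))))
      (isZero-+r (ordL u + ordR u) (dpart u) tu)

  classes : ℕ
  classes = countF least

  classesEq : classes ≡ isolated P F + [ withD F ] + circuits P F
  classesEq = trans (countF-part least (uncovered P F))
    (trans (cong₂ _+_ (countF-ext e1) (trans (countF-part (λ u → least u ∧ not (uncovered P F u)) (onPath P F)) (cong₂ _+_ e2 e3)))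
      (sym (+-assoc (isolated P F) _ _)))
    where
    e1 : ∀ u → (least u ∧ uncovered P F u) ≡ uncovered P F u
    e1 u with T-dec (uncovered P F u)
    ... | inj₁ t rewrite T-≡ t | T-≡ (unc-least u t) = refl
    ... | inj₂ t rewrite F-≡ t = ∧-zeroʳ (least u)
    e2 : countF (λ u → (least u ∧ not (uncovered P F u)) ∧ onPath P F u) ≡ [ withD F ]
    e2 = e2' (withD F) refl
      where
      e2' : ∀ b → withD F ≡ b → countF (λ u → (least u ∧ not (uncovered P F u)) ∧ onPath P F u) ≡ [ b ]
      e2' false eqD = countF-zero _ (λ u t → T-sub eqD (∧-el {withD F} (∧-er {least u ∧ not (uncovered P F u)} t)))
      e2' true eqD = trans (countF-ext f) (trans (countF-ext (λ u → ∧-comm (least u) (conn (dang₁ P) u))) (leastInClass (dang₁ P)))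
        where
        f : ∀ u → ((least u ∧ not (uncovered P F u)) ∧ onPath P F u) ≡ (least u ∧ conn (dang₁ P) u)
        f u = T-ext (λ t → ∧-i (∧-el (∧-el {least u ∧ not (uncovered P F u)} t))
                                (T-sub (connF≡ _ _) (∧-er {withD F} (∧-er {least u ∧ not (uncovered P F u)} t))))
                    (λ t → let to = ∧-i {withD F} (≡-T eqD) (T-sub (sym (connF≡ _ _)) (∧-er {least u} t)) in
                       ∧-i {least u ∧ not (uncovered P F u)} (∧-i (∧-el t) (not-T (onPath-unc u to))) to)
    e3 : countF (λ u → (least u ∧ not (uncovered P F u)) ∧ not (onPath P F u)) ≡ circuits P F
    e3 = countF-ext (λ u → trans (cong (λ z → (z ∧ not (uncovered P F u)) ∧ not (onPath P F u)) (lq u))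
              (bl _ (not (uncovered P F u)) (not (onPath P F u))))
      where
      lq : ∀ u → least u ≡ not (anyF (λ w → ⌊ w <? u ⌋ ∧ connF P F u w))
      lq u = cong not (anyF-ext (λ w → cong (⌊ w <? u ⌋ ∧_) (sym (connF≡ u w))))
      bl : ∀ a b c → ((a ∧ b) ∧ c) ≡ (b ∧ c ∧ a)
      bl a b c = prove 3 ((x ⊕ y) ⊕ z) (y ⊕ (z ⊕ x)) (a ∷ b ∷ c ∷ [])
        where x = var zero
              y = var (suc zero)
              z = var (suc (suc zero))


sumF : ∀ {k} → (Fin k → ℕ) → ℕ
sumF {zero} f = 0
sumF {suc k} f = f zero + sumF (λ i → f (suc i))

sumF-ext : ∀ {k} {f g : Fin k → ℕ} → (∀ i → f i ≡ g i) → sumF f ≡ sumF g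
sumF-ext {zero} e = refl
sumF-ext {suc k} e = cong₂ _+_ (e zero) (sumF-ext (λ i → e (suc i)))

sumF-0 : ∀ {k} → sumF {k} (λ _ → 0) ≡ 0
sumF-0 {zero} = refl
sumF-0 {suc k} = sumF-0 {k}

sumF-+ : ∀ {k} (f g : Fin k → ℕ) → sumF (λ i → f i + g i) ≡ sumF f + sumF g
sumF-+ {zero} f g = refl
sumF-+ {suc k} f g = trans (cong (f zero + g zero +_) (sumF-+ (λ i → f (suc i)) (λ i → g (suc i))))
  (swap4 (f zero) (g zero) _ _)

countF-sum : ∀ {k} (f : Fin k → Bool) → countF f ≡ sumF (λ i → [ f i ])
countF-sum {zero} f = refl
countF-sum {suc k} f = cong ([ f zero ] +_) (countF-sum (λ i → f (suc i)))

sumF-swap : ∀ {k l} (g : Fin k → Fin l → ℕ) → sumF (λ v → sumF (λ e → g v e)) ≡ sumF (λ e → sumF (λ v → g v e))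
sumF-swap {zero} {l} g = sym (sumF-0 {l})
sumF-swap {suc k} {l} g = trans (cong (sumF (λ e → g zero e) +_) (sumF-swap (λ v e → g (suc v) e)))
  (sym (sumF-+ (λ e → g zero e) (λ e → sumF (λ v → g (suc v) e))))

countF-swap : ∀ {k l} (h : Fin k → Fin l → Bool) → sumF (λ v → countF (λ e → h v e)) ≡ sumF (λ e → countF (λ v → h v e))
countF-swap h = trans (sumF-ext (λ v → countF-sum (h v)))
  (trans (sumF-swap (λ v e → [ h v e ])) (sym (sumF-ext (λ e → countF-sum (λ v → h v e)))))

single : ∀ {k} (x : Fin k) (p : Fin k → Bool) → countF (λ v → (x == v) ∧ p v) ≡ [ p x ]
single {suc k} zero p =
  trans (cong (λ z → [ z ∧ p zero ] + countF (λ i → ((zero {k}) == suc i) ∧ p (suc i))) (T-≡ (==-refl (zero {k}))))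
   (trans (cong ([ p zero ] +_) (countF-zero (λ i → ((zero {k}) == suc i) ∧ p (suc i)) (λ u t → lem u (∧-el {(zero {k}) == suc u} {p (suc u)} t)))) (+-identityʳ _))
  where lem : ∀ u → ¬ T ((zero {k}) == suc u)
        lem u t with ==-sound {i = zero {k}} {j = suc u} t
        ... | ()
single {suc k} (suc x) p =
  trans (cong (λ z → [ z ∧ p zero ] + countF (λ i → (Fin.suc x == suc i) ∧ p (suc i))) (==-false {i = suc x} {j = zero} (λ ())))
  (trans (countF-ext (λ u → cong (_∧ p (suc u)) (eqs u)))
     (single x (λ v → p (suc v))))
  where
  eqs : ∀ u → (Fin.suc x == suc u) ≡ (x == u)
  eqs u = T-ext (λ t → fromWitness {a? = x ≟ u} (FP.suc-injective (==-sound {i = Fin.suc x} {j = suc u} t)))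
                (λ t → fromWitness {a? = Fin.suc x ≟ suc u} (cong (λ (z : Fin k) → Fin.suc z) (==-sound {i = x} {j = u} t)))

ifCount : ∀ {l} (b : Bool) (f : Fin l → Bool) → (if b then countF f else 0) ≡ countF (λ e → b ∧ f e)
ifCount true f = refl
ifCount {l} false f = sym (countF-zero {l} _ (λ _ ()))

Even : ℕ → Set
Even s = Σ ℕ λ Z → s ≡ Z + Z

even-sum : ∀ {k} (g : Fin k → ℕ) → (∀ v → g v ≡ 0 ⊎ g v ≡ 2) → Even (sumF g)
even-sum {zero} g h = 0 , refl
even-sum {suc k} g h with even-sum (λ i → g (suc i)) (λ i → h (suc i)) | h zero
... | Z , e | inj₁ e0 = Z , trans (cong₂ _+_ e0 e) refl
... | Z , e | inj₂ e2 = suc Z , trans (cong₂ _+_ e2 e) (cong suc (sym (+-suc Z Z)))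

even-diff : ∀ X Y s → Y + Y ≡ X + X + s → Even s
even-diff zero Y s e = Y , sym e
even-diff (suc X) zero s ()
even-diff (suc X) (suc Y) s e = even-diff X Y s
  (suc-injective (suc-injective (trans (trans (cong suc (sym (+-suc Y Y))) e) (cong (λ z → suc z + s) (+-suc X X)))))

not-odd : ∀ Z → ¬ (1 ≡ Z + Z)
not-odd zero ()
not-odd (suc Z) e with trans (suc-injective e) (+-suc Z Z)
... | ()

even-bb : ∀ a b → Even ([ a ] + [ b ]) → a ≡ b
even-bb true true _ = refl
even-bb false false _ = refl
even-bb true false (Z , e) = ⊥-elim (not-odd Z e)
even-bb false true (Z , e) = ⊥-elim (not-odd Z e)

-- Handshake lemma: on a union S of components of F (S closed along F-edges)
-- where every vertex has total degree 0 or 2, the extra degree D summed over S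
-- is even, since the F-edge ends inside S are counted twice.
module Handshake (P : Pole) (F : Factor P) where
  open FactorGraph P F

  on : (Fin (n P) → Bool) → (Fin (n P) → ℕ) → Fin (n P) → ℕ
  on S h v = if S v then h v else 0

  endsIn : (S : Fin (n P) → Bool) (end : Fin (m P) → Fin (n P)) →
    sumF (on S (λ v → countF (λ e → inF F e ∧ (end e == v)))) ≡ countF (λ e → inF F e ∧ S (end e))
  endsIn S end = begin
    sumF (on S (λ v → countF (λ e → inF F e ∧ (end e == v))))
      ≡⟨ sumF-ext (λ v → ifCount (S v) (λ e → inF F e ∧ (end e == v))) ⟩
    sumF (λ v → countF (λ e → S v ∧ inF F e ∧ (end e == v)))
      ≡⟨ countF-swap (λ v e → S v ∧ inF F e ∧ (end e == v)) ⟩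
    sumF (λ e → countF (λ v → S v ∧ inF F e ∧ (end e == v)))
      ≡⟨ sumF-ext (λ e → trans (countF-ext (λ v → ∧-rotate (S v) (inF F e) (end e == v)))
                                (single (end e) (λ v → inF F e ∧ S v))) ⟩
    sumF (λ e → [ inF F e ∧ S (end e) ])
      ≡⟨ sym (countF-sum (λ e → inF F e ∧ S (end e))) ⟩
    countF (λ e → inF F e ∧ S (end e)) ∎
    where open ≡-Reasoning

  handshake : (S : Fin (n P) → Bool) → (∀ e → T (inF F e) → S (end₁ P e) ≡ S (end₂ P e)) →
    (D : Fin (n P) → ℕ) → (∀ v → T (S v) → ordL v + ordR v + D v ≡ 0 ⊎ ordL v + ordR v + D v ≡ 2) →
    Even (sumF (λ v → if S v then D v else 0))
  handshake S closed D ev = even-diff X (proj₁ evenTotal) (sumF (on S D)) (begin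
      proj₁ evenTotal + proj₁ evenTotal
        ≡⟨ sym (proj₂ evenTotal) ⟩
      sumF (on S total)
        ≡⟨ sumF-ext split ⟩
      sumF (λ v → on S ordL v + on S ordR v + on S D v)
        ≡⟨ sumF-+ (λ v → on S ordL v + on S ordR v) (on S D) ⟩
      sumF (λ v → on S ordL v + on S ordR v) + sumF (on S D)
        ≡⟨ cong (_+ sumF (on S D)) (sumF-+ (on S ordL) (on S ordR)) ⟩
      sumF (on S ordL) + sumF (on S ordR) + sumF (on S D)
        ≡⟨ cong (λ z → sumF (on S ordL) + z + sumF (on S D)) (trans (endsIn S (end₂ P)) sameEnds) ⟩
      sumF (on S ordL) + X + sumF (on S D)
        ≡⟨ cong (λ z → z + X + sumF (on S D)) (endsIn S (end₁ P)) ⟩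
      X + X + sumF (on S D) ∎)
    where
    open ≡-Reasoning
    -- the number of F-edges inside S (both ends are in S, as S is closed)
    X : ℕ
    X = countF (λ e → inF F e ∧ S (end₁ P e))
    sameEnds : countF (λ e → inF F e ∧ S (end₂ P e)) ≡ X
    sameEnds = countF-ext sameEnd
      where
      sameEnd : ∀ e → (inF F e ∧ S (end₂ P e)) ≡ (inF F e ∧ S (end₁ P e))
      sameEnd e with inF F e in eI
      ... | true = sym (closed e (T-sub (sym eI) tt))
      ... | false = refl
    total : Fin (n P) → ℕ
    total v = ordL v + ordR v + D v
    evenTotal : Even (sumF (on S total))
    evenTotal = even-sum (on S total) onEven
      where
      onEven : ∀ v → on S total v ≡ 0 ⊎ on S total v ≡ 2
      onEven v with S v in eS
      ... | true = ev v (T-sub (sym eS) tt)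
      ... | false = inj₁ refl
    split : ∀ v → on S total v ≡ on S ordL v + on S ordR v + on S D v
    split v with S v
    ... | true = refl
    ... | false = refl


sumSingle : ∀ {k} (c : Bool) (t : Fin k) → sumF (λ v → [ c ∧ (t == v) ]) ≡ [ c ]
sumSingle c t = trans (sym (countF-sum (λ v → c ∧ (t == v))))
  (trans (countF-ext (λ v → ∧-comm c (t == v))) (single t (λ _ → c)))

-- In an even factor through the dangling edges, both dangling vertices lie in
-- the same component: the component of dang₁ has odd dangling degree
-- otherwise, contradicting the handshake lemma.
pathEnds : (P : Pole) (F : Factor P) → IsEven P F → withD F ≡ true → T (FactorGraph.conn P F (dang₁ P) (dang₂ P))
pathEnds P F ev wd = ≡-T (sym (even-bb true (S (dang₂ P)) (subst Even sumEq hs)))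
  where
  open FactorGraph P F
  S : Fin (n P) → Bool
  S = conn (dang₁ P)
  cl : ∀ e → T (inF F e) → S (end₁ P e) ≡ S (end₂ P e)
  cl e t = T-ext (λ s → conn-trans _ _ _ s (Conn⇒reach (Conn-1 (adj-intro e t))))
                 (λ s → conn-trans _ _ _ s (Conn⇒reach (Conn-1 (adj-sym _ _ (adj-intro e t)))))
  hs : Even (sumF (λ v → if S v then dpart v else 0))
  hs = Handshake.handshake P F S cl dpart (λ v _ → ev v)
  sumEq : sumF (λ v → if S v then dpart v else 0) ≡ [ true ] + [ S (dang₂ P) ]
  sumEq = trans (sumF-ext lem)
    (trans (sumF-+ (λ v → [ (dang₁ P == v) ∧ S v ]) (λ v → [ (dang₂ P == v) ∧ S v ]))
      (cong₂ _+_ (trans (sym (countF-sum (λ v → (dang₁ P == v) ∧ S v))) (trans (single (dang₁ P) S) (cong [_] (T-≡ (reach-refl (n P) (dang₁ P))))))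
                 (trans (sym (countF-sum (λ v → (dang₂ P == v) ∧ S v))) (single (dang₂ P) S))))
    where
    dp≡ : ∀ v → dpart v ≡ [ dang₁ P == v ] + [ dang₂ P == v ]
    dp≡ v = cong (λ z → if z then [ dang₁ P == v ] + [ dang₂ P == v ] else 0) wd
    lem : ∀ v → (if S v then dpart v else 0) ≡ [ (dang₁ P == v) ∧ S v ] + [ (dang₂ P == v) ∧ S v ]
    lem v with S v
    ... | true = trans (dp≡ v) (sym (cong₂ _+_ (cong [_] (∧-identityʳ (dang₁ P == v))) (cong [_] (∧-identityʳ (dang₂ P == v)))))
    ... | false = sym (cong₂ _+_ (cong [_] (∧-zeroʳ (dang₁ P == v))) (cong [_] (∧-zeroʳ (dang₂ P == v))))


module FactorExt (P : Pole) (F G : Factor P) (eI : ∀ e → inF F e ≡ inF G e) (eW : withD F ≡ withD G) where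
  degE : ∀ v → degF P F v ≡ degF P G v
  degE v = cong₂ _+_ (cong₂ _+_ (countF-ext (λ e → cong (_∧ (end₁ P e == v)) (eI e)))
                                (countF-ext (λ e → cong (_∧ (end₂ P e == v)) (eI e))))
                     (cong (λ b → if b then [ dang₁ P == v ] + [ dang₂ P == v ] else 0) eW)
  adjE : ∀ u w → adjF P F u w ≡ adjF P G u w
  adjE u w = anyF-ext (λ e → cong (_∧ (((end₁ P e == u) ∧ (end₂ P e == w)) ∨ ((end₁ P e == w) ∧ (end₂ P e == u)))) (eI e))
  reachE : ∀ j u w → reachF P F j u w ≡ reachF P G j u w
  reachE zero u w = refl
  reachE (suc j) u w = cong₂ _∨_ (reachE j u w) (anyF-ext (λ x → cong₂ _∧_ (reachE j u x) (adjE x w)))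
  uncE : ∀ u → uncovered P F u ≡ uncovered P G u
  uncE u = cong isZero (degE u)
  onE : ∀ u → onPath P F u ≡ onPath P G u
  onE u = cong₂ _∧_ eW (reachE (n P) (dang₁ P) u)
  repE : ∀ u → circuitRep P F u ≡ circuitRep P G u
  repE u = cong₂ _∧_ (cong not (uncE u)) (cong₂ _∧_ (cong not (onE u))
             (cong not (anyF-ext (λ w → cong (⌊ w <? u ⌋ ∧_) (reachE (n P) u w)))))
  excessE : excess P F ≡ excess P G
  excessE = cong₂ _+_ (cong (2 *_) (countF-ext repE)) (countF-ext uncE)
  evenE : IsEven P F → IsEven P G
  evenE ev v = subst (λ z → z ≡ 0 ⊎ z ≡ 2) (degE v) (ev v)

-- excess + isolated + 2·[path] = 2·#components, since excess = 2c + v and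
-- #components = v + [path] + c.
excessEq : (P : Pole) (F : Factor P) →
  excess P F + isolated P F + [ withD F ] + [ withD F ] ≡ FactorGraph.classes P F + FactorGraph.classes P F
excessEq P F rewrite FactorGraph.classesEq P F =
  solve 3 (λ i w c → ((c :+ (c :+ con 0)) :+ i) :+ i :+ w :+ w := (i :+ w :+ c) :+ (i :+ w :+ c)) refl
    (isolated P F) [ withD F ] (circuits P F)


==-inj : ∀ {p q} (f : Fin p → Fin q) → (∀ {i j} → f i ≡ f j → i ≡ j) → ∀ i j → (f i == f j) ≡ (i == j)
==-inj f inj i j = T-ext (λ t → fromWitness (inj (==-sound t))) (λ t → fromWitness (cong f (==-sound t)))

↑ˡ-== : ∀ {p} q (i j : Fin p) → ((i ↑ˡ q) == (j ↑ˡ q)) ≡ (i == j)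
↑ˡ-== q = ==-inj (_↑ˡ q) (λ {i} {j} → FP.↑ˡ-injective q i j)

↑ʳ-== : ∀ p {q} (i j : Fin q) → ((p ↑ʳ i) == (p ↑ʳ j)) ≡ (i == j)
↑ʳ-== p = ==-inj (p ↑ʳ_) (λ {i} {j} → FP.↑ʳ-injective p i j)

lr-ne : ∀ {p q} (i : Fin p) (j : Fin q) → (i ↑ˡ q) ≢ (p ↑ʳ j)
lr-ne {p} {q} i j e = <⇒≱ (FP.toℕ<n i) (≤-trans (m≤m+n p (toℕ j))
   (≤-reflexive (trans (sym (FP.toℕ-↑ʳ p j)) (trans (cong toℕ (sym e)) (FP.toℕ-↑ˡ i q)))))

lr-== : ∀ {p q} (i : Fin p) (j : Fin q) → ((i ↑ˡ q) == (p ↑ʳ j)) ≡ false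
lr-== i j = ==-false (lr-ne i j)
rl-== : ∀ {p q} (i : Fin p) (j : Fin q) → ((p ↑ʳ j) == (i ↑ˡ q)) ≡ false
rl-== i j = ==-false (λ e → lr-ne i j (sym e))

lt-toℕ : ∀ {k l} (a c : Fin k) (b d : Fin l) → toℕ a ≡ toℕ b → toℕ c ≡ toℕ d → ⌊ a <? c ⌋ ≡ ⌊ b <? d ⌋
lt-toℕ a c b d e1 e2 = T-ext (λ t → fromWitness (subst₂ (λ x y → suc x ≤ y) e1 e2 (toWitness t)))
                              (λ t → fromWitness (subst₂ (λ x y → suc x ≤ y) (sym e1) (sym e2) (toWitness t)))

lt-true : ∀ {k} (a c : Fin k) → toℕ a < toℕ c → ⌊ a <? c ⌋ ≡ true
lt-true a c lt = T-≡ (fromWitness lt)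
lt-false : ∀ {k} (a c : Fin k) → ¬ (toℕ a < toℕ c) → ⌊ a <? c ⌋ ≡ false
lt-false a c nlt = isYes-false (a <? c) nlt

data View3 {p r : ℕ} : Fin ((p + p) + r) → Set where
  v1 : ∀ i → View3 ((i ↑ˡ p) ↑ˡ r)
  v2 : ∀ i → View3 ((p ↑ʳ i) ↑ˡ r)
  v3 : ∀ j → View3 ((p + p) ↑ʳ j)

view3 : ∀ p r (x : Fin ((p + p) + r)) → View3 {p} {r} x
view3 p r x = subst View3 (FP.join-splitAt (p + p) r x) (go (splitAt (p + p) x))
  where
  go2 : ∀ (y : Fin (p + p)) → View3 {p} {r} (y ↑ˡ r)
  go2 y = subst (λ z → View3 {p} {r} (z ↑ˡ r)) (FP.join-splitAt p p y) (go3 (splitAt p y))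
    where go3 : ∀ s → View3 {p} {r} (Fin.join p p s ↑ˡ r)
          go3 (inj₁ i) = v1 i
          go3 (inj₂ i) = v2 i
  go : ∀ s → View3 {p} {r} (Fin.join (p + p) r s)
  go (inj₁ y) = go2 y
  go (inj₂ j) = v3 j


module Layout (A : Pole) (f₁ f₂ : Bool) where
  open Construction A f₁ f₂ public

  ce1 ce2 : Fin (m A) → Fin M
  ce1 e = (e ↑ˡ m A) ↑ˡ 7
  ce2 e = (m A ↑ʳ e) ↑ˡ 7
  ne : Fin 7 → Fin M
  ne k = (m A + m A) ↑ʳ k

  e1-ce1 : ∀ e → end₁ A' (ce1 e) ≡ c₁ (end₁ A e)
  e1-ce1 e rewrite FP.splitAt-↑ˡ (m A + m A) (e ↑ˡ m A) 7 | FP.splitAt-↑ˡ (m A) e (m A) = refl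
  e2-ce1 : ∀ e → end₂ A' (ce1 e) ≡ c₁ (end₂ A e)
  e2-ce1 e rewrite FP.splitAt-↑ˡ (m A + m A) (e ↑ˡ m A) 7 | FP.splitAt-↑ˡ (m A) e (m A) = refl
  e1-ce2 : ∀ e → end₁ A' (ce2 e) ≡ c₂ (end₁ A e)
  e1-ce2 e rewrite FP.splitAt-↑ˡ (m A + m A) (m A ↑ʳ e) 7 | FP.splitAt-↑ʳ (m A) (m A) e = refl
  e2-ce2 : ∀ e → end₂ A' (ce2 e) ≡ c₂ (end₂ A e)
  e2-ce2 e rewrite FP.splitAt-↑ˡ (m A + m A) (m A ↑ʳ e) 7 | FP.splitAt-↑ʳ (m A) (m A) e = refl
  e1-ne : ∀ k → end₁ A' (ne k) ≡ newEnd₁ k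
  e1-ne k rewrite FP.splitAt-↑ʳ (m A + m A) 7 k = refl
  e2-ne : ∀ k → end₂ A' (ne k) ≡ newEnd₂ k
  e2-ne k rewrite FP.splitAt-↑ʳ (m A + m A) 7 k = refl

  c1c1 : ∀ i j → (c₁ i == c₁ j) ≡ (i == j)
  c1c1 i j = trans (↑ˡ-== 4 _ _) (↑ˡ-== (n A) i j)
  c2c2 : ∀ i j → (c₂ i == c₂ j) ≡ (i == j)
  c2c2 i j = trans (↑ˡ-== 4 _ _) (↑ʳ-== (n A) i j)
  c1c2 : ∀ i j → (c₁ i == c₂ j) ≡ false
  c1c2 i j = trans (↑ˡ-== 4 _ _) (lr-== i j)
  c2c1 : ∀ i j → (c₂ i == c₁ j) ≡ false
  c2c1 i j = trans (↑ˡ-== 4 _ _) (rl-== j i)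
  c1nw : ∀ i j → (c₁ i == new j) ≡ false
  c1nw i j = lr-== (i ↑ˡ n A) j
  nwc1 : ∀ j i → (new j == c₁ i) ≡ false
  nwc1 j i = rl-== (i ↑ˡ n A) j
  c2nw : ∀ i j → (c₂ i == new j) ≡ false
  c2nw i j = lr-== (n A ↑ʳ i) j
  nwc2 : ∀ j i → (new j == c₂ i) ≡ false
  nwc2 j i = rl-== (n A ↑ʳ i) j
  nwnw : ∀ i j → (new i == new j) ≡ (i == j)
  nwnw i j = ↑ʳ-== (n A + n A) i j

  tc1 : ∀ i → toℕ (c₁ i) ≡ toℕ i
  tc1 i = trans (FP.toℕ-↑ˡ (i ↑ˡ n A) 4) (FP.toℕ-↑ˡ i (n A))
  tc2 : ∀ i → toℕ (c₂ i) ≡ n A + toℕ i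
  tc2 i = trans (FP.toℕ-↑ˡ (n A ↑ʳ i) 4) (FP.toℕ-↑ʳ (n A) i)
  tnw : ∀ j → toℕ (new j) ≡ (n A + n A) + toℕ j
  tnw j = FP.toℕ-↑ʳ (n A + n A) j

  lt-c1c1 : ∀ j i → ⌊ c₁ j <? c₁ i ⌋ ≡ ⌊ j <? i ⌋
  lt-c1c1 j i = lt-toℕ (c₁ j) (c₁ i) j i (tc1 j) (tc1 i)
  lt-c2c2 : ∀ j i → ⌊ c₂ j <? c₂ i ⌋ ≡ ⌊ j <? i ⌋
  lt-c2c2 j i = T-ext (λ t → fromWitness (+-cancelˡ-< (n A) _ _ (subst₂ _<_ (tc2 j) (tc2 i) (toWitness t))))
                      (λ t → fromWitness (subst₂ _<_ (sym (tc2 j)) (sym (tc2 i)) (+-monoʳ-< (n A) (toWitness t))))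
  lt-nwnw : ∀ j i → ⌊ new j <? new i ⌋ ≡ ⌊ j <? i ⌋
  lt-nwnw j i = T-ext (λ t → fromWitness (+-cancelˡ-< (n A + n A) _ _ (subst₂ _<_ (tnw j) (tnw i) (toWitness t))))
                      (λ t → fromWitness (subst₂ _<_ (sym (tnw j)) (sym (tnw i)) (+-monoʳ-< (n A + n A) (toWitness t))))
  i<n : ∀ (i : Fin (n A)) → toℕ i < n A
  i<n i = FP.toℕ<n i
  lt-c1c2 : ∀ j i → ⌊ c₁ j <? c₂ i ⌋ ≡ true
  lt-c1c2 j i = lt-true (c₁ j) (c₂ i) (subst₂ _<_ (sym (tc1 j)) (sym (tc2 i)) (m≤n⇒m≤n+o (toℕ i) (i<n j)))
  lt-c1nw : ∀ j i → ⌊ c₁ j <? new i ⌋ ≡ true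
  lt-c1nw j i = lt-true (c₁ j) (new i) (subst₂ _<_ (sym (tc1 j)) (sym (tnw i)) (m≤n⇒m≤n+o (toℕ i) (m≤n⇒m≤n+o (n A) (i<n j))))
  lt-c2nw : ∀ j i → ⌊ c₂ j <? new i ⌋ ≡ true
  lt-c2nw j i = lt-true (c₂ j) (new i) (subst₂ _<_ (sym (tc2 j)) (sym (tnw i)) (m≤n⇒m≤n+o (toℕ i) (+-monoʳ-< (n A) (i<n j))))
  lt-c2c1 : ∀ j i → ⌊ c₂ j <? c₁ i ⌋ ≡ false
  lt-c2c1 j i = lt-false (c₂ j) (c₁ i) (λ lt → <⇒≱ (subst₂ _<_ (tc2 j) (tc1 i) lt)
                  (≤-trans (<⇒≤ (i<n i)) (m≤m+n (n A) (toℕ j))))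
  lt-nwc1 : ∀ j i → ⌊ new j <? c₁ i ⌋ ≡ false
  lt-nwc1 j i = lt-false (new j) (c₁ i) (λ lt → <⇒≱ (subst₂ _<_ (tnw j) (tc1 i) lt)
                  (≤-trans (<⇒≤ (i<n i)) (≤-trans (m≤m+n (n A) (n A)) (m≤m+n (n A + n A) (toℕ j)))))
  lt-nwc2 : ∀ j i → ⌊ new j <? c₂ i ⌋ ≡ false
  lt-nwc2 j i = lt-false (new j) (c₂ i) (λ lt → <⇒≱ (subst₂ _<_ (tnw j) (tc2 i) lt)
                  (≤-trans (<⇒≤ (+-monoʳ-< (n A) (i<n i))) (m≤m+n (n A + n A) (toℕ j))))


-- F1 (F2) takes the
-- edges of F' in copy 1 (copy 2) and uses the dangling edges iff F' uses the
-- new edge from that copy to x₁.  The degree of F' at a copy vertex is its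
-- degree in the restriction plus the new edges at it; a handshake argument on
-- the copy shows the two new edges at a copy are used together, so the
-- restrictions are even factors of A.
module Restriction (A : Pole) (f₁ f₂ : Bool) (F' : Factor (doubled A f₁ f₂)) where
  open Layout A f₁ f₂ public

  b : Fin 7 → Bool
  b k = inF F' (ne k)
  d : Bool
  d = withD F'

  F1 F2 : Factor A
  F1 = record { inF = λ e → inF F' (ce1 e) ; withD = b zero }
  F2 = record { inF = λ e → inF F' (ce2 e) ; withD = b (suc (suc zero)) }

  countE : (g : Fin M → Bool) → countF g ≡ countF (λ e → g (ce1 e)) + countF (λ e → g (ce2 e)) + countF (λ k → g (ne k))
  countE g = trans (countF-split (m A + m A) 7 g) (cong (_+ countF (λ k → g (ne k))) (countF-split (m A) (m A) (λ i → g (i ↑ˡ 7))))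

  countV : (g : Fin N → Bool) → countF g ≡ countF (λ i → g (c₁ i)) + countF (λ i → g (c₂ i)) + countF (λ k → g (new k))
  countV g = trans (countF-split (n A + n A) 4 g) (cong (_+ countF (λ k → g (new k))) (countF-split (n A) (n A) (λ i → g (i ↑ˡ 4))))

  anyV : (g : Fin N → Bool) → anyF g ≡ ((anyF (λ i → g (c₁ i)) ∨ anyF (λ i → g (c₂ i))) ∨ anyF (λ k → g (new k)))
  anyV g = trans (anyF-split (n A + n A) 4 g) (cong (_∨ anyF (λ k → g (new k))) (anyF-split (n A) (n A) (λ i → g (i ↑ˡ 4))))

  N1 N2 : Fin N → ℕ
  N1 v = countF (λ k → b k ∧ (newEnd₁ k == v))
  N2 v = countF (λ k → b k ∧ (newEnd₂ k == v))

  LLsplit : ∀ v → countF (λ e → inF F' e ∧ (end₁ A' e == v)) ≡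
    countF (λ e → inF F1 e ∧ (c₁ (end₁ A e) == v)) + countF (λ e → inF F2 e ∧ (c₂ (end₁ A e) == v)) + N1 v
  LLsplit v = trans (countE _) (cong₂ _+_ (cong₂ _+_
     (countF-ext (λ e → cong (λ z → inF F' (ce1 e) ∧ (z == v)) (e1-ce1 e)))
     (countF-ext (λ e → cong (λ z → inF F' (ce2 e) ∧ (z == v)) (e1-ce2 e))))
     (countF-ext (λ k → cong (λ z → b k ∧ (z == v)) (e1-ne k))))
  RRsplit : ∀ v → countF (λ e → inF F' e ∧ (end₂ A' e == v)) ≡
    countF (λ e → inF F1 e ∧ (c₁ (end₂ A e) == v)) + countF (λ e → inF F2 e ∧ (c₂ (end₂ A e) == v)) + N2 v
  RRsplit v = trans (countE _) (cong₂ _+_ (cong₂ _+_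
     (countF-ext (λ e → cong (λ z → inF F' (ce1 e) ∧ (z == v)) (e2-ce1 e)))
     (countF-ext (λ e → cong (λ z → inF F' (ce2 e) ∧ (z == v)) (e2-ce2 e))))
     (countF-ext (λ k → cong (λ z → b k ∧ (z == v)) (e2-ne k))))

  dp : Fin N → ℕ
  dp v = if d then [ y₁ == v ] + [ y₂ == v ] else 0

  degSplit : ∀ v → degF A' F' v ≡ (countF (λ e → inF F1 e ∧ (c₁ (end₁ A e) == v)) + countF (λ e → inF F2 e ∧ (c₂ (end₁ A e) == v)) + N1 v)
     + (countF (λ e → inF F1 e ∧ (c₁ (end₂ A e) == v)) + countF (λ e → inF F2 e ∧ (c₂ (end₂ A e) == v)) + N2 v) + dp v
  degSplit v = cong₂ _+_ (cong₂ _+_ (LLsplit v) (RRsplit v)) refl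

  ordL1 ordR1 ordL2 ordR2 : Fin (n A) → ℕ
  ordL1 = FactorGraph.ordL A F1
  ordR1 = FactorGraph.ordR A F1
  ordL2 = FactorGraph.ordL A F2
  ordR2 = FactorGraph.ordR A F2

  t1₁ t2₁ t1₂ t2₂ : Fin (n A)
  t1₁ = toX₁ f₁
  t2₁ = toX₂ f₁
  t1₂ = toX₁ f₂
  t2₂ = toX₂ f₂

  tabc1 : Fin (n A) → Fin 7 → Bool
  tabc1 i zero = b zero ∧ (t1₁ == i)
  tabc1 i (suc zero) = b (suc zero) ∧ (t2₁ == i)
  tabc1 i _ = false

  N1c1 : ∀ i k → (b k ∧ (newEnd₁ k == c₁ i)) ≡ tabc1 i k
  N1c1 i zero = cong (b zero ∧_) (c1c1 t1₁ i)
  N1c1 i (suc zero) = cong (b (suc zero) ∧_) (c1c1 t2₁ i)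
  N1c1 i (suc (suc zero)) = trans (cong (b (suc (suc zero)) ∧_) (c2c1 _ i)) (∧-zeroʳ _)
  N1c1 i (suc (suc (suc zero))) = trans (cong (b _ ∧_) (c2c1 _ i)) (∧-zeroʳ _)
  N1c1 i (suc (suc (suc (suc zero)))) = trans (cong (b _ ∧_) (nwc1 _ i)) (∧-zeroʳ _)
  N1c1 i (suc (suc (suc (suc (suc zero))))) = trans (cong (b _ ∧_) (nwc1 _ i)) (∧-zeroʳ _)
  N1c1 i (suc (suc (suc (suc (suc (suc zero)))))) = trans (cong (b _ ∧_) (nwc1 _ i)) (∧-zeroʳ _)

  N2c1 : ∀ i k → (b k ∧ (newEnd₂ k == c₁ i)) ≡ false
  N2c1 i zero = trans (cong (b _ ∧_) (nwc1 _ i)) (∧-zeroʳ _)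
  N2c1 i (suc zero) = trans (cong (b _ ∧_) (nwc1 _ i)) (∧-zeroʳ _)
  N2c1 i (suc (suc zero)) = trans (cong (b _ ∧_) (nwc1 _ i)) (∧-zeroʳ _)
  N2c1 i (suc (suc (suc zero))) = trans (cong (b _ ∧_) (nwc1 _ i)) (∧-zeroʳ _)
  N2c1 i (suc (suc (suc (suc zero)))) = trans (cong (b _ ∧_) (nwc1 _ i)) (∧-zeroʳ _)
  N2c1 i (suc (suc (suc (suc (suc zero))))) = trans (cong (b _ ∧_) (nwc1 _ i)) (∧-zeroʳ _)
  N2c1 i (suc (suc (suc (suc (suc (suc zero)))))) = trans (cong (b _ ∧_) (nwc1 _ i)) (∧-zeroʳ _)

  tabc2 : Fin (n A) → Fin 7 → Bool
  tabc2 i (suc (suc zero)) = b (suc (suc zero)) ∧ (t1₂ == i)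
  tabc2 i (suc (suc (suc zero))) = b (suc (suc (suc zero))) ∧ (t2₂ == i)
  tabc2 i _ = false

  N1c2 : ∀ i k → (b k ∧ (newEnd₁ k == c₂ i)) ≡ tabc2 i k
  N1c2 i zero = trans (cong (b _ ∧_) (c1c2 _ i)) (∧-zeroʳ _)
  N1c2 i (suc zero) = trans (cong (b _ ∧_) (c1c2 _ i)) (∧-zeroʳ _)
  N1c2 i (suc (suc zero)) = cong (b _ ∧_) (c2c2 t1₂ i)
  N1c2 i (suc (suc (suc zero))) = cong (b _ ∧_) (c2c2 t2₂ i)
  N1c2 i (suc (suc (suc (suc zero)))) = trans (cong (b _ ∧_) (nwc2 _ i)) (∧-zeroʳ _)
  N1c2 i (suc (suc (suc (suc (suc zero))))) = trans (cong (b _ ∧_) (nwc2 _ i)) (∧-zeroʳ _)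
  N1c2 i (suc (suc (suc (suc (suc (suc zero)))))) = trans (cong (b _ ∧_) (nwc2 _ i)) (∧-zeroʳ _)

  N2c2 : ∀ i k → (b k ∧ (newEnd₂ k == c₂ i)) ≡ false
  N2c2 i zero = trans (cong (b _ ∧_) (nwc2 _ i)) (∧-zeroʳ _)
  N2c2 i (suc zero) = trans (cong (b _ ∧_) (nwc2 _ i)) (∧-zeroʳ _)
  N2c2 i (suc (suc zero)) = trans (cong (b _ ∧_) (nwc2 _ i)) (∧-zeroʳ _)
  N2c2 i (suc (suc (suc zero))) = trans (cong (b _ ∧_) (nwc2 _ i)) (∧-zeroʳ _)
  N2c2 i (suc (suc (suc (suc zero)))) = trans (cong (b _ ∧_) (nwc2 _ i)) (∧-zeroʳ _)
  N2c2 i (suc (suc (suc (suc (suc zero))))) = trans (cong (b _ ∧_) (nwc2 _ i)) (∧-zeroʳ _)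
  N2c2 i (suc (suc (suc (suc (suc (suc zero)))))) = trans (cong (b _ ∧_) (nwc2 _ i)) (∧-zeroʳ _)

  dpc1 : ∀ i → dp (c₁ i) ≡ 0
  dpc1 i with d
  ... | false = refl
  ... | true rewrite nwc1 (suc (suc zero)) i | nwc1 (suc (suc (suc zero))) i = refl
  dpc2 : ∀ i → dp (c₂ i) ≡ 0
  dpc2 i with d
  ... | false = refl
  ... | true rewrite nwc2 (suc (suc zero)) i | nwc2 (suc (suc (suc zero))) i = refl

  arith : ∀ a x c y z → (a + 0 + x) + (c + 0 + y) + z ≡ a + c + (x + y + z)
  arith = solve 5 (λ a x c y z → (a :+ con 0 :+ x) :+ (c :+ con 0 :+ y) :+ z := a :+ c :+ (x :+ y :+ z)) refl

  deg-c1 : ∀ i → degF A' F' (c₁ i) ≡ ordL1 i + ordR1 i + (([ b zero ∧ (t1₁ == i) ] + ([ b (suc zero) ∧ (t2₁ == i) ] + 0)) + 0 + 0)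
  deg-c1 i = trans (degSplit (c₁ i))
    (trans (cong₂ _+_ (cong₂ _+_
       (cong₂ _+_ (cong₂ _+_ (countF-ext (λ e → cong (inF F1 e ∧_) (c1c1 _ i))) (countF-allFalse _ (λ e → trans (cong (inF F2 e ∧_) (c2c1 _ i)) (∧-zeroʳ _))))
                  (countF-ext (N1c1 i)))
       (cong₂ _+_ (cong₂ _+_ (countF-ext (λ e → cong (inF F1 e ∧_) (c1c1 _ i))) (countF-allFalse _ (λ e → trans (cong (inF F2 e ∧_) (c2c1 _ i)) (∧-zeroʳ _))))
                  (countF-allFalse _ (N2c1 i))))
       (dpc1 i))
     (arith (ordL1 i) _ (ordR1 i) 0 0))

  deg-c2 : ∀ i → degF A' F' (c₂ i) ≡ ordL2 i + ordR2 i + (([ b (suc (suc zero)) ∧ (t1₂ == i) ] + ([ b (suc (suc (suc zero))) ∧ (t2₂ == i) ] + 0)) + 0 + 0)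
  deg-c2 i = trans (degSplit (c₂ i))
    (trans (cong₂ _+_ (cong₂ _+_
       (trans (cong₂ _+_ (cong₂ _+_ (countF-allFalse _ (λ e → trans (cong (inF F1 e ∧_) (c1c2 _ i)) (∧-zeroʳ _))) (countF-ext (λ e → cong (inF F2 e ∧_) (c2c2 _ i))))
                  (countF-ext (N1c2 i))) (cong (_+ countF (tabc2 i)) (+-comm 0 (ordL2 i))))
       (trans (cong₂ _+_ (cong₂ _+_ (countF-allFalse _ (λ e → trans (cong (inF F1 e ∧_) (c1c2 _ i)) (∧-zeroʳ _))) (countF-ext (λ e → cong (inF F2 e ∧_) (c2c2 _ i))))
                  (countF-allFalse _ (N2c2 i))) (cong (_+ 0) (+-comm 0 (ordR2 i)))))
       (dpc2 i))
     (arith (ordL2 i) _ (ordR2 i) 0 0))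


  -- names for the seven new edges:
  -- c₁x₁ c₁x₂ c₂x₁ c₂x₂ x₁y₁ y₁y₂ y₂x₂
  b0 b1 b2 b3 b4 b5 b6 : Bool
  b0 = b zero
  b1 = b (suc zero)
  b2 = b (suc (suc zero))
  b3 = b (suc (suc (suc zero)))
  b4 = b (suc (suc (suc (suc zero))))
  b5 = b (suc (suc (suc (suc (suc zero)))))
  b6 = b (suc (suc (suc (suc (suc (suc zero))))))

  copyExtraDegree : ∀ (c c' : Bool) (t t' : Fin (n A)) →
    sumF (λ v → if true then ([ c ∧ (t == v) ] + ([ c' ∧ (t' == v) ] + 0)) + 0 + 0 else 0) ≡ [ c ] + [ c' ]
  copyExtraDegree c c' t t' = trans (sumF-ext (λ v → trans (+-identityʳ _) (trans (+-identityʳ _) (cong ([ c ∧ (t == v) ] +_) (+-identityʳ _)))))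
    (trans (sumF-+ (λ v → [ c ∧ (t == v) ]) (λ v → [ c' ∧ (t' == v) ])) (cong₂ _+_ (sumSingle c t) (sumSingle c' t')))

  parity1 : IsEven A' F' → b1 ≡ b0
  parity1 ev = sym (even-bb b0 b1 (subst Even (copyExtraDegree b0 b1 t1₁ t2₁)
     (Handshake.handshake A F1 (λ _ → true) (λ e _ → refl) _ (λ v _ → subst (λ z → z ≡ 0 ⊎ z ≡ 2) (deg-c1 v) (ev (c₁ v))))))
  parity2 : IsEven A' F' → b3 ≡ b2
  parity2 ev = sym (even-bb b2 b3 (subst Even (copyExtraDegree b2 b3 t1₂ t2₂)
     (Handshake.handshake A F2 (λ _ → true) (λ e _ → refl) _ (λ v _ → subst (λ z → z ≡ 0 ⊎ z ≡ 2) (deg-c2 v) (ev (c₂ v))))))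

  flipLem : ∀ (f c : Bool) (i : Fin (n A)) →
    ([ c ∧ (toX₁ f == i) ] + ([ c ∧ (toX₂ f == i) ] + 0)) + 0 + 0 ≡ (if c then [ dang₁ A == i ] + [ dang₂ A == i ] else 0)
  flipLem false true i = trans (+-identityʳ _) (trans (+-identityʳ _) (cong ([ dang₁ A == i ] +_) (+-identityʳ _)))
  flipLem true true i = trans (+-identityʳ _) (trans (+-identityʳ _) (trans (cong ([ dang₂ A == i ] +_) (+-identityʳ _)) (+-comm [ dang₂ A == i ] [ dang₁ A == i ])))
  flipLem f false i = refl

  deg1 : b1 ≡ b0 → ∀ i → degF A' F' (c₁ i) ≡ degF A F1 i
  deg1 e i = trans (deg-c1 i) (cong (ordL1 i + ordR1 i +_)
    (trans (cong (λ z → ([ b0 ∧ (t1₁ == i) ] + ([ z ∧ (t2₁ == i) ] + 0)) + 0 + 0) e) (flipLem f₁ b0 i)))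
  deg2 : b3 ≡ b2 → ∀ i → degF A' F' (c₂ i) ≡ degF A F2 i
  deg2 e i = trans (deg-c2 i) (cong (ordL2 i + ordR2 i +_)
    (trans (cong (λ z → ([ b2 ∧ (t1₂ == i) ] + ([ z ∧ (t2₂ == i) ] + 0)) + 0 + 0) e) (flipLem f₂ b2 i)))

  even-F1 : IsEven A' F' → IsEven A F1
  even-F1 ev v = subst (λ z → z ≡ 0 ⊎ z ≡ 2) (deg1 (parity1 ev) v) (ev (c₁ v))
  even-F2 : IsEven A' F' → IsEven A F2
  even-F2 ev v = subst (λ z → z ≡ 0 ⊎ z ≡ 2) (deg2 (parity2 ev) v) (ev (c₂ v))

  tabN1 : Fin 4 → Fin 7 → Bool
  tabN1 j (suc (suc (suc (suc zero)))) = b4 ∧ (zero == j)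
  tabN1 j (suc (suc (suc (suc (suc zero))))) = b5 ∧ (suc (suc zero) == j)
  tabN1 j (suc (suc (suc (suc (suc (suc zero)))))) = b6 ∧ (suc (suc (suc zero)) == j)
  tabN1 j _ = false

  tabN2 : Fin 4 → Fin 7 → Bool
  tabN2 j zero = b0 ∧ (zero == j)
  tabN2 j (suc zero) = b1 ∧ (suc zero == j)
  tabN2 j (suc (suc zero)) = b2 ∧ (zero == j)
  tabN2 j (suc (suc (suc zero))) = b3 ∧ (suc zero == j)
  tabN2 j (suc (suc (suc (suc zero)))) = b4 ∧ (suc (suc zero) == j)
  tabN2 j (suc (suc (suc (suc (suc zero))))) = b5 ∧ (suc (suc (suc zero)) == j)
  tabN2 j (suc (suc (suc (suc (suc (suc zero)))))) = b6 ∧ (suc zero == j)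

  N1n : ∀ j k → (b k ∧ (newEnd₁ k == new j)) ≡ tabN1 j k
  N1n j zero = trans (cong (b _ ∧_) (c1nw _ j)) (∧-zeroʳ _)
  N1n j (suc zero) = trans (cong (b _ ∧_) (c1nw _ j)) (∧-zeroʳ _)
  N1n j (suc (suc zero)) = trans (cong (b _ ∧_) (c2nw _ j)) (∧-zeroʳ _)
  N1n j (suc (suc (suc zero))) = trans (cong (b _ ∧_) (c2nw _ j)) (∧-zeroʳ _)
  N1n j (suc (suc (suc (suc zero)))) = cong (b _ ∧_) (nwnw _ j)
  N1n j (suc (suc (suc (suc (suc zero))))) = cong (b _ ∧_) (nwnw _ j)
  N1n j (suc (suc (suc (suc (suc (suc zero)))))) = cong (b _ ∧_) (nwnw _ j)

  N2n : ∀ j k → (b k ∧ (newEnd₂ k == new j)) ≡ tabN2 j k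
  N2n j zero = cong (b _ ∧_) (nwnw _ j)
  N2n j (suc zero) = cong (b _ ∧_) (nwnw _ j)
  N2n j (suc (suc zero)) = cong (b _ ∧_) (nwnw _ j)
  N2n j (suc (suc (suc zero))) = cong (b _ ∧_) (nwnw _ j)
  N2n j (suc (suc (suc (suc zero)))) = cong (b _ ∧_) (nwnw _ j)
  N2n j (suc (suc (suc (suc (suc zero))))) = cong (b _ ∧_) (nwnw _ j)
  N2n j (suc (suc (suc (suc (suc (suc zero)))))) = cong (b _ ∧_) (nwnw _ j)

  dpN : Fin 4 → ℕ
  dpN j = if d then [ suc (suc zero) == j ] + [ suc (suc (suc zero)) == j ] else 0

  dpn : ∀ j → dp (new j) ≡ dpN j
  dpn j = cong (λ z → if d then z else 0) (cong₂ _+_ (cong [_] (nwnw _ j)) (cong [_] (nwnw _ j)))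

  degN : Fin 4 → ℕ
  degN j = countF (tabN1 j) + countF (tabN2 j) + dpN j

  deg-new : ∀ j → degF A' F' (new j) ≡ degN j
  deg-new j = trans (degSplit (new j))
    (cong₂ _+_ (cong₂ _+_
       (cong₂ _+_ (cong₂ _+_ (countF-allFalse _ (λ e → trans (cong (inF F1 e ∧_) (c1nw _ j)) (∧-zeroʳ _))) (countF-allFalse _ (λ e → trans (cong (inF F2 e ∧_) (c2nw _ j)) (∧-zeroʳ _))))
                  (countF-ext (N1n j)))
       (cong₂ _+_ (cong₂ _+_ (countF-allFalse _ (λ e → trans (cong (inF F1 e ∧_) (c1nw _ j)) (∧-zeroʳ _))) (countF-allFalse _ (λ e → trans (cong (inF F2 e ∧_) (c2nw _ j)) (∧-zeroʳ _))))
                  (countF-ext (N2n j))))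
       (dpn j))


-- The quotient graph on six nodes: the dangling path of copy 1, that of copy 2,
-- and x₁ x₂ y₁ y₂, with the new edges used by F' (edge c₁x₁ standing for both
-- edges of copy 1, which are used together).
edgeS : (b0 b2 b4 b5 b6 : Bool) → Fin 6 → Fin 6 → Bool
edgeS b0 b2 b4 b5 b6 s t =
  ((s == zero) ∧ (t == suc (suc zero)) ∧ b0) ∨
  ((s == zero) ∧ (t == suc (suc (suc zero))) ∧ b0) ∨
  ((s == suc zero) ∧ (t == suc (suc zero)) ∧ b2) ∨
  ((s == suc zero) ∧ (t == suc (suc (suc zero))) ∧ b2) ∨
  ((s == suc (suc zero)) ∧ (t == suc (suc (suc (suc zero)))) ∧ b4) ∨
  ((s == suc (suc (suc (suc zero)))) ∧ (t == suc (suc (suc (suc (suc zero))))) ∧ b5) ∨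
  ((s == suc (suc (suc (suc (suc zero))))) ∧ (t == suc (suc (suc zero))) ∧ b6)

supAdj : (b0 b2 b4 b5 b6 : Bool) → Fin 6 → Fin 6 → Bool
supAdj b0 b2 b4 b5 b6 s t = edgeS b0 b2 b4 b5 b6 s t ∨ edgeS b0 b2 b4 b5 b6 t s

supAdj-sym : ∀ b0 b2 b4 b5 b6 s t → T (supAdj b0 b2 b4 b5 b6 s t) → T (supAdj b0 b2 b4 b5 b6 t s)
supAdj-sym b0 b2 b4 b5 b6 s t x = T-sub (∨-comm (edgeS b0 b2 b4 b5 b6 s t) _) x

-- Connectivity in the quotient graph; abstract so that it is not unfolded
-- when the component identity is typechecked.
abstract
  connS : (b0 b2 b4 b5 b6 : Bool) → Fin 6 → Fin 6 → Bool
  connS b0 b2 b4 b5 b6 = Graph.conn (supAdj b0 b2 b4 b5 b6)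

  connS-def : ∀ b0 b2 b4 b5 b6 s t → connS b0 b2 b4 b5 b6 s t ≡ Graph.conn (supAdj b0 b2 b4 b5 b6) s t
  connS-def b0 b2 b4 b5 b6 s t = refl

  connS⇒ : ∀ b0 b2 b4 b5 b6 s t → T (connS b0 b2 b4 b5 b6 s t) → Graph.Conn (supAdj b0 b2 b4 b5 b6) s t
  connS⇒ b0 b2 b4 b5 b6 s t x = Graph.reach⇒Conn (supAdj b0 b2 b4 b5 b6) 6 x

  ⇒connS : ∀ b0 b2 b4 b5 b6 s t → Graph.Conn (supAdj b0 b2 b4 b5 b6) s t → T (connS b0 b2 b4 b5 b6 s t)
  ⇒connS b0 b2 b4 b5 b6 s t x = Graph.Conn⇒reach (supAdj b0 b2 b4 b5 b6) x

  connS-refl : ∀ b0 b2 b4 b5 b6 s → T (connS b0 b2 b4 b5 b6 s s)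
  connS-refl b0 b2 b4 b5 b6 s = Graph.reach-refl (supAdj b0 b2 b4 b5 b6) 6 s

  connS-row : ∀ b0 b2 b4 b5 b6 s t → T (connS b0 b2 b4 b5 b6 s t) → ∀ x → connS b0 b2 b4 b5 b6 s x ≡ connS b0 b2 b4 b5 b6 t x
  connS-row b0 b2 b4 b5 b6 = Graph.Sym.conn-row (supAdj b0 b2 b4 b5 b6) (supAdj-sym b0 b2 b4 b5 b6)

-- For an equivalence relation given by a Boolean test, two elements are
-- related iff their rows are equal: rows serve as component labels.
row-eq : ∀ {k} (c : Fin k → Fin k → Bool) (refl' : ∀ u → T (c u u)) →
  (∀ u w → T (c u w) → ∀ x → c u x ≡ c w x) →
  ∀ u w → (tabulate (c u) ≡ tabulate (c w) → T (c u w)) × (T (c u w) → tabulate (c u) ≡ tabulate (c w))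
row-eq c rf rw u w = (λ e → T-sub (sym (trans (sym (lookup∘tabulate (c u) w)) (trans (cong (λ v → lookup v w) e) (lookup∘tabulate (c w) w)))) (rf w))
                   , (λ t → tabulate-cong (rw u w t))

isL : ∀ {X Y : Set} → X ⊎ Y → Bool
isL (inj₁ _) = true
isL (inj₂ _) = false

clash : ∀ {X Y : Set} {x : X} {y : Y} → inj₁ {B = Y} x ≡ inj₂ y → ⊥
clash e with cong isL e
... | ()

-- Each vertex gets a label κ:
-- a copy vertex on its copy's dangling path (when that copy is attached)
-- and a new vertex get the label of their node in the quotient graph, other
-- copy vertices the label of their component in the restriction.  Vertices
-- are connected in F' iff their labels agree, which determines the least
-- vertex of every component of F'.
module Components (A : Pole) (f₁ f₂ : Bool) (F' : Factor (doubled A f₁ f₂)) (ev : IsEven (doubled A f₁ f₂) F') where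
  open Restriction A f₁ f₂ F' public
  module G' = FactorGraph A' F'
  module G1 = FactorGraph A F1
  module G2 = FactorGraph A F2
  module GS = Graph (supAdj b0 b2 b4 b5 b6)

  cS : Fin 6 → Fin 6 → Bool
  cS = connS b0 b2 b4 b5 b6

  P1 P2 : Fin (n A) → Bool
  P1 = G1.conn (dang₁ A)
  P2 = G2.conn (dang₁ A)

  pb1 : b1 ≡ b0
  pb1 = parity1 ev
  pb3 : b3 ≡ b2
  pb3 = parity2 ev
  ev1 : IsEven A F1
  ev1 = even-F1 ev
  ev2 : IsEven A F2
  ev2 = even-F2 ev

  edgeC : ∀ e {u w} → T (inF F' e) → end₁ A' e ≡ u → end₂ A' e ≡ w → G'.Conn u w
  edgeC e t refl refl = G'.Conn-1 (G'.adj-intro e t)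

  lift1 : ∀ {i j} → G1.Conn i j → G'.Conn (c₁ i) (c₁ j)
  lift1 = liftConn (adjF A F1) (adjF A' F') c₁ h
    where
    h : ∀ u w → T (adjF A F1 u w) → G'.Conn (c₁ u) (c₁ w)
    h u w a with G1.adj-elim u w a
    ... | e , t , inj₁ (refl , refl) = edgeC (ce1 e) t (e1-ce1 e) (e2-ce1 e)
    ... | e , t , inj₂ (refl , refl) = G'.Conn-sym (edgeC (ce1 e) t (e1-ce1 e) (e2-ce1 e))
  lift2 : ∀ {i j} → G2.Conn i j → G'.Conn (c₂ i) (c₂ j)
  lift2 = liftConn (adjF A F2) (adjF A' F') c₂ h
    where
    h : ∀ u w → T (adjF A F2 u w) → G'.Conn (c₂ u) (c₂ w)
    h u w a with G2.adj-elim u w a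
    ... | e , t , inj₁ (refl , refl) = edgeC (ce2 e) t (e1-ce2 e) (e2-ce2 e)
    ... | e , t , inj₂ (refl , refl) = G'.Conn-sym (edgeC (ce2 e) t (e1-ce2 e) (e2-ce2 e))

  ends1 : T b0 → ∀ f → T (P1 (toX₁ f)) × T (P1 (toX₂ f))
  ends1 tb false = G1.reach-refl (n A) (dang₁ A) , pathEnds A F1 ev1 (T-≡ tb)
  ends1 tb true = pathEnds A F1 ev1 (T-≡ tb) , G1.reach-refl (n A) (dang₁ A)
  ends2 : T b2 → ∀ f → T (P2 (toX₁ f)) × T (P2 (toX₂ f))
  ends2 tb false = G2.reach-refl (n A) (dang₁ A) , pathEnds A F2 ev2 (T-≡ tb)
  ends2 tb true = pathEnds A F2 ev2 (T-≡ tb) , G2.reach-refl (n A) (dang₁ A)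

  base : Fin 6 → Fin N
  base zero = c₁ (dang₁ A)
  base (suc zero) = c₂ (dang₁ A)
  base (suc (suc j)) = new j

  c1toBase : ∀ i → T (P1 i) → G'.Conn (c₁ i) (base zero)
  c1toBase i t = lift1 (G1.reach⇒Conn (n A) (G1.conn-sym _ _ t))
  c2toBase : ∀ i → T (P2 i) → G'.Conn (c₂ i) (base (suc zero))
  c2toBase i t = lift2 (G2.reach⇒Conn (n A) (G2.conn-sym _ _ t))

  tb1 : T b1 → T b0
  tb1 t = T-sub pb1 t
  tb3 : T b3 → T b2
  tb3 t = T-sub pb3 t

  dis : ∀ {s t : Fin 6} (s0 t0 : Fin 6) (c : Bool) → T ((s == s0) ∧ (t == t0) ∧ c) → (s ≡ s0) × (t ≡ t0) × T c
  dis {s} {t} s0 t0 c x = ==-sound {i = s} (∧-el x) , ==-sound {i = t} (∧-el (∧-er {s == s0} x)) , ∧-er {t == t0} (∧-er {s == s0} x)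

  e0 e1 e2 e3 e4 e5 e6 : Fin 7
  e0 = zero
  e1 = suc zero
  e2 = suc (suc zero)
  e3 = suc (suc (suc zero))
  e4 = suc (suc (suc (suc zero)))
  e5 = suc (suc (suc (suc (suc zero))))
  e6 = suc (suc (suc (suc (suc (suc zero)))))

  edgeLift : ∀ s t → T (edgeS b0 b2 b4 b5 b6 s t) → G'.Conn (base s) (base t)
  edgeLift s t x with ∨-e x
  ... | inj₁ y with dis {s} {t} zero (suc (suc zero)) b0 y
  ... | refl , refl , tb = G'.Conn-trans (G'.Conn-sym (c1toBase t1₁ (proj₁ (ends1 tb f₁))))
                        (edgeC (ne e0) tb (e1-ne e0) (e2-ne e0))
  edgeLift s t x | inj₂ x1 with ∨-e x1
  ... | inj₁ y with dis {s} {t} zero (suc (suc (suc zero))) b0 y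
  ... | refl , refl , tb = G'.Conn-trans (G'.Conn-sym (c1toBase t2₁ (proj₂ (ends1 tb f₁))))
                        (edgeC (ne e1) (T-sub (sym pb1) tb) (e1-ne e1) (e2-ne e1))
  edgeLift s t x | inj₂ x1 | inj₂ x2 with ∨-e x2
  ... | inj₁ y with dis {s} {t} (suc zero) (suc (suc zero)) b2 y
  ... | refl , refl , tb = G'.Conn-trans (G'.Conn-sym (c2toBase t1₂ (proj₁ (ends2 tb f₂))))
                        (edgeC (ne e2) tb (e1-ne e2) (e2-ne e2))
  edgeLift s t x | inj₂ x1 | inj₂ x2 | inj₂ x3 with ∨-e x3
  ... | inj₁ y with dis {s} {t} (suc zero) (suc (suc (suc zero))) b2 y
  ... | refl , refl , tb = G'.Conn-trans (G'.Conn-sym (c2toBase t2₂ (proj₂ (ends2 tb f₂))))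
                        (edgeC (ne e3) (T-sub (sym pb3) tb) (e1-ne e3) (e2-ne e3))
  edgeLift s t x | inj₂ x1 | inj₂ x2 | inj₂ x3 | inj₂ x4 with ∨-e x4
  ... | inj₁ y with dis {s} {t} (suc (suc zero)) (suc (suc (suc (suc zero)))) b4 y
  ... | refl , refl , tb = edgeC (ne e4) tb (e1-ne e4) (e2-ne e4)
  edgeLift s t x | inj₂ x1 | inj₂ x2 | inj₂ x3 | inj₂ x4 | inj₂ x5 with ∨-e x5
  ... | inj₁ y with dis {s} {t} (suc (suc (suc (suc zero)))) (suc (suc (suc (suc (suc zero))))) b5 y
  ... | refl , refl , tb = edgeC (ne e5) tb (e1-ne e5) (e2-ne e5)
  edgeLift s t x | inj₂ x1 | inj₂ x2 | inj₂ x3 | inj₂ x4 | inj₂ x5 | inj₂ y with dis {s} {t} (suc (suc (suc (suc (suc zero))))) (suc (suc (suc zero))) b6 y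
  ... | refl , refl , tb = edgeC (ne e6) tb (e1-ne e6) (e2-ne e6)

  supLift : ∀ s t → T (supAdj b0 b2 b4 b5 b6 s t) → G'.Conn (base s) (base t)
  supLift s t x with ∨-e {edgeS b0 b2 b4 b5 b6 s t} x
  ... | inj₁ y = edgeLift s t y
  ... | inj₂ y = G'.Conn-sym (edgeLift t s y)

  quotientLift : ∀ s t → T (cS s t) → G'.Conn (base s) (base t)
  quotientLift s t x = liftConn (supAdj b0 b2 b4 b5 b6) (adjF A' F') base supLift {s} {t} (connS⇒ b0 b2 b4 b5 b6 s t x)

  K : Set
  K = Vec Bool (n A) ⊎ (Vec Bool (n A) ⊎ Vec Bool 6)

  rowS : Fin 6 → Vec Bool 6
  rowS s = tabulate (cS s)
  row1 row2 : Fin (n A) → Vec Bool (n A)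
  row1 i = tabulate (G1.conn i)
  row2 i = tabulate (G2.conn i)

  rowS-iff : ∀ s t → (rowS s ≡ rowS t → T (cS s t)) × (T (cS s t) → rowS s ≡ rowS t)
  rowS-iff = row-eq cS (connS-refl b0 b2 b4 b5 b6) (connS-row b0 b2 b4 b5 b6)
  row1-iff : ∀ i j → (row1 i ≡ row1 j → T (G1.conn i j)) × (T (G1.conn i j) → row1 i ≡ row1 j)
  row1-iff = row-eq G1.conn (G1.reach-refl (n A)) G1.conn-row
  row2-iff : ∀ i j → (row2 i ≡ row2 j → T (G2.conn i j)) × (T (G2.conn i j) → row2 i ≡ row2 j)
  row2-iff = row-eq G2.conn (G2.reach-refl (n A)) G2.conn-row

  κ1 κ2 : Fin (n A) → K
  κ1 i = if b0 ∧ P1 i then inj₂ (inj₂ (rowS zero)) else inj₁ (row1 i)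
  κ2 i = if b2 ∧ P2 i then inj₂ (inj₂ (rowS (suc zero))) else inj₂ (inj₁ (row2 i))
  κN : Fin 4 → K
  κN j = inj₂ (inj₂ (rowS (suc (suc j))))

  κ12 : Fin (n A + n A) → K
  κ12 y = [ κ1 , κ2 ]′ (splitAt (n A) y)
  κ : Fin N → K
  κ v = [ κ12 , κN ]′ (splitAt (n A + n A) v)

  κc1 : ∀ i → κ (c₁ i) ≡ κ1 i
  κc1 i rewrite FP.splitAt-↑ˡ (n A + n A) (i ↑ˡ n A) 4 | FP.splitAt-↑ˡ (n A) i (n A) = refl
  κc2 : ∀ i → κ (c₂ i) ≡ κ2 i
  κc2 i rewrite FP.splitAt-↑ˡ (n A + n A) (n A ↑ʳ i) 4 | FP.splitAt-↑ʳ (n A) (n A) i = refl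
  κnw : ∀ j → κ (new j) ≡ κN j
  κnw j rewrite FP.splitAt-↑ʳ (n A + n A) 4 j = refl

  κ1-T : ∀ i → T (b0 ∧ P1 i) → κ (c₁ i) ≡ inj₂ (inj₂ (rowS zero))
  κ1-T i t = trans (κc1 i) (cong (λ z → if z then inj₂ (inj₂ (rowS zero)) else inj₁ (row1 i)) (T-≡ t))
  κ1-F : ∀ i → ¬ T (b0 ∧ P1 i) → κ (c₁ i) ≡ inj₁ (row1 i)
  κ1-F i t = trans (κc1 i) (cong (λ z → if z then inj₂ (inj₂ (rowS zero)) else inj₁ (row1 i)) (F-≡ t))
  κ2-T : ∀ i → T (b2 ∧ P2 i) → κ (c₂ i) ≡ inj₂ (inj₂ (rowS (suc zero)))
  κ2-T i t = trans (κc2 i) (cong (λ z → if z then inj₂ (inj₂ (rowS (suc zero))) else inj₂ (inj₁ (row2 i))) (T-≡ t))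
  κ2-F : ∀ i → ¬ T (b2 ∧ P2 i) → κ (c₂ i) ≡ inj₂ (inj₁ (row2 i))
  κ2-F i t = trans (κc2 i) (cong (λ z → if z then inj₂ (inj₂ (rowS (suc zero))) else inj₂ (inj₁ (row2 i))) (F-≡ t))

  getS : K → Vec Bool 6
  getS (inj₂ (inj₂ r)) = r
  getS (inj₁ _) = rowS zero
  getS (inj₂ (inj₁ _)) = rowS zero
  get1 : K → Vec Bool (n A)
  get1 (inj₁ r) = r
  get1 _ = row1 (dang₁ A)
  get2 : K → Vec Bool (n A)
  get2 (inj₂ (inj₁ r)) = r
  get2 _ = row1 (dang₁ A)

  data KV (v : Fin N) : Set where
    kS : (s : Fin 6) → κ v ≡ inj₂ (inj₂ (rowS s)) → G'.Conn v (base s) → KV v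
    k1 : (i : Fin (n A)) → v ≡ c₁ i → κ v ≡ inj₁ (row1 i) → KV v
    k2 : (i : Fin (n A)) → v ≡ c₂ i → κ v ≡ inj₂ (inj₁ (row2 i)) → KV v

  kv' : ∀ v → View3 {n A} {4} v → KV v
  kv' _ (v1 i) with T-dec (b0 ∧ P1 i)
  ... | inj₁ t = kS zero (κ1-T i t) (c1toBase i (∧-er {b0} t))
  ... | inj₂ t = k1 i refl (κ1-F i t)
  kv' _ (v2 i) with T-dec (b2 ∧ P2 i)
  ... | inj₁ t = kS (suc zero) (κ2-T i t) (c2toBase i (∧-er {b2} t))
  ... | inj₂ t = k2 i refl (κ2-F i t)
  kv' _ (v3 j) = kS (suc (suc j)) (κnw j) G'.here

  kv : ∀ v → KV v
  kv v = kv' v (view3 (n A) 4 v)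

  complete : ∀ u w → κ u ≡ κ w → G'.Conn u w
  complete u w e with kv u | kv w
  ... | kS s eu cu | kS t ew cw =
        G'.Conn-trans cu (G'.Conn-trans (quotientLift s t (proj₁ (rowS-iff s t) (cong getS (trans (sym eu) (trans e ew))))) (G'.Conn-sym cw))
  ... | kS s eu cu | k1 j refl ew with trans (sym eu) (trans e ew)
  ... | ()
  complete u w e | kS s eu cu | k2 j refl ew with trans (sym eu) (trans e ew)
  ... | ()
  complete u w e | k1 i refl eu | kS t ew cw with trans (sym eu) (trans e ew)
  ... | ()
  complete u w e | k1 i refl eu | k1 j refl ew = lift1 (G1.reach⇒Conn (n A) (proj₁ (row1-iff i j) (cong get1 (trans (sym eu) (trans e ew)))))
  complete u w e | k1 i refl eu | k2 j refl ew with trans (sym eu) (trans e ew)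
  ... | ()
  complete u w e | k2 i refl eu | kS t ew cw with trans (sym eu) (trans e ew)
  ... | ()
  complete u w e | k2 i refl eu | k1 j refl ew with trans (sym eu) (trans e ew)
  ... | ()
  complete u w e | k2 i refl eu | k2 j refl ew = lift2 (G2.reach⇒Conn (n A) (proj₁ (row2-iff i j) (cong get2 (trans (sym eu) (trans e ew)))))

  κ1-conn : ∀ i j → T (G1.conn i j) → κ1 i ≡ κ1 j
  κ1-conn i j c = cong₂ (λ p r → if b0 ∧ p then inj₂ (inj₂ (rowS zero)) else inj₁ r)
    (T-ext (λ p → G1.conn-trans _ i j p c) (λ p → G1.conn-trans _ j i p (G1.conn-sym i j c)))
    (proj₂ (row1-iff i j) c)
  κ2-conn : ∀ i j → T (G2.conn i j) → κ2 i ≡ κ2 j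
  κ2-conn i j c = cong₂ (λ p r → if b2 ∧ p then inj₂ (inj₂ (rowS (suc zero))) else inj₂ (inj₁ r))
    (T-ext (λ p → G2.conn-trans _ i j p c) (λ p → G2.conn-trans _ j i p (G2.conn-sym i j c)))
    (proj₂ (row2-iff i j) c)

  supE : ∀ s t → T (edgeS b0 b2 b4 b5 b6 s t) → rowS s ≡ rowS t
  supE s t x = proj₂ (rowS-iff s t) (⇒connS b0 b2 b4 b5 b6 s t (GS.Conn-1 (∨-il {edgeS b0 b2 b4 b5 b6 s t} x)))

  keyE' : ∀ e → View3 {m A} {7} e → T (inF F' e) → κ (end₁ A' e) ≡ κ (end₂ A' e)
  keyE' _ (v1 e) t rewrite e1-ce1 e | e2-ce1 e =
    trans (κc1 _) (trans (κ1-conn _ _ (G1.Conn⇒reach (G1.Conn-1 (G1.adj-intro e t)))) (sym (κc1 _)))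
  keyE' _ (v2 e) t rewrite e1-ce2 e | e2-ce2 e =
    trans (κc2 _) (trans (κ2-conn _ _ (G2.Conn⇒reach (G2.Conn-1 (G2.adj-intro e t)))) (sym (κc2 _)))
  keyE' _ (v3 zero) t rewrite e1-ne e0 | e2-ne e0 =
    trans (κ1-T t1₁ (∧-i t (proj₁ (ends1 t f₁)))) (trans (cong (λ r → inj₂ (inj₂ r)) (supE zero (suc (suc zero)) (∨-il t))) (sym (κnw zero)))
  keyE' _ (v3 (suc zero)) t rewrite e1-ne e1 | e2-ne e1 =
    trans (κ1-T t2₁ (∧-i (tb1 t) (proj₂ (ends1 (tb1 t) f₁)))) (trans (cong (λ r → inj₂ (inj₂ r)) (supE zero (suc (suc (suc zero))) (∨-il (tb1 t)))) (sym (κnw (suc zero))))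
  keyE' _ (v3 (suc (suc zero))) t rewrite e1-ne e2 | e2-ne e2 =
    trans (κ2-T t1₂ (∧-i t (proj₁ (ends2 t f₂)))) (trans (cong (λ r → inj₂ (inj₂ r)) (supE (suc zero) (suc (suc zero)) (∨-il t))) (sym (κnw zero)))
  keyE' _ (v3 (suc (suc (suc zero)))) t rewrite e1-ne e3 | e2-ne e3 =
    trans (κ2-T t2₂ (∧-i (tb3 t) (proj₂ (ends2 (tb3 t) f₂)))) (trans (cong (λ r → inj₂ (inj₂ r)) (supE (suc zero) (suc (suc (suc zero))) (∨-il (tb3 t)))) (sym (κnw (suc zero))))
  keyE' _ (v3 (suc (suc (suc (suc zero))))) t rewrite e1-ne e4 | e2-ne e4 =
    trans (κnw zero) (trans (cong (λ r → inj₂ (inj₂ r)) (supE (suc (suc zero)) (suc (suc (suc (suc zero)))) (∨-il t))) (sym (κnw (suc (suc zero)))))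
  keyE' _ (v3 (suc (suc (suc (suc (suc zero)))))) t rewrite e1-ne e5 | e2-ne e5 =
    trans (κnw (suc (suc zero))) (trans (cong (λ r → inj₂ (inj₂ r)) (supE (suc (suc (suc (suc zero)))) (suc (suc (suc (suc (suc zero))))) (∨-il t))) (sym (κnw (suc (suc (suc zero))))))
  keyE' _ (v3 (suc (suc (suc (suc (suc (suc zero))))))) t rewrite e1-ne e6 | e2-ne e6 =
    trans (κnw (suc (suc (suc zero)))) (trans (cong (λ r → inj₂ (inj₂ r)) (supE (suc (suc (suc (suc (suc zero))))) (suc (suc (suc zero))) t)) (sym (κnw (suc zero))))

  keyEdge : ∀ e → T (inF F' e) → κ (end₁ A' e) ≡ κ (end₂ A' e)
  keyEdge e = keyE' e (view3 (m A) 7 e)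

  conn-κ : ∀ u w → T (G'.conn u w) → κ u ≡ κ w
  conn-κ u w t = G'.keyConn κ keyEdge (G'.reach⇒Conn (n A') t)
  κ-conn : ∀ u w → κ u ≡ κ w → T (G'.conn u w)
  κ-conn u w e = G'.Conn⇒reach (complete u w e)


  getR : K → Vec Bool (n A) ⊎ Vec Bool 6
  getR (inj₂ z) = z
  getR (inj₁ z) = inj₁ z

  κS : Fin 6 → K
  κS s = inj₂ (inj₂ (rowS s))

  conn-c₁c₁ : ∀ i j → G'.conn (c₁ i) (c₁ j) ≡ G1.conn i j
  conn-c₁c₁ i j = T-ext to (λ t → κ-conn _ _ (trans (κc1 i) (trans (κ1-conn i j t) (sym (κc1 j)))))
    where
    to : T (G'.conn (c₁ i) (c₁ j)) → T (G1.conn i j)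
    to t with conn-κ _ _ t | T-dec (b0 ∧ P1 i) | T-dec (b0 ∧ P1 j)
    ... | e | inj₁ x | inj₁ y = G1.conn-trans i (dang₁ A) j (G1.conn-sym _ _ (∧-er {b0} x)) (∧-er {b0} y)
    ... | e | inj₂ x | inj₂ y = proj₁ (row1-iff i j) (cong get1 (trans (sym (κ1-F i x)) (trans e (κ1-F j y))))
    ... | e | inj₁ x | inj₂ y = ⊥-elim (clash (sym (trans (sym (κ1-T i x)) (trans e (κ1-F j y)))))
    ... | e | inj₂ x | inj₁ y = ⊥-elim (clash (trans (sym (κ1-F i x)) (trans e (κ1-T j y))))

  conn-c₂c₂ : ∀ i j → G'.conn (c₂ i) (c₂ j) ≡ G2.conn i j
  conn-c₂c₂ i j = T-ext to (λ t → κ-conn _ _ (trans (κc2 i) (trans (κ2-conn i j t) (sym (κc2 j)))))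
    where
    to : T (G'.conn (c₂ i) (c₂ j)) → T (G2.conn i j)
    to t with conn-κ _ _ t | T-dec (b2 ∧ P2 i) | T-dec (b2 ∧ P2 j)
    ... | e | inj₁ x | inj₁ y = G2.conn-trans i (dang₁ A) j (G2.conn-sym _ _ (∧-er {b2} x)) (∧-er {b2} y)
    ... | e | inj₂ x | inj₂ y = proj₁ (row2-iff i j) (cong get2 (trans (sym (κ2-F i x)) (trans e (κ2-F j y))))
    ... | e | inj₁ x | inj₂ y = ⊥-elim (clash (sym (cong getR (trans (sym (κ2-T i x)) (trans e (κ2-F j y))))))
    ... | e | inj₂ x | inj₁ y = ⊥-elim (clash (cong getR (trans (sym (κ2-F i x)) (trans e (κ2-T j y)))))

  ss : Fin 4 → Fin 6
  ss j = suc (suc j)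

  rS : ∀ {s t} → T (cS s t) → κS s ≡ κS t
  rS {s} {t} c = cong (λ r → inj₂ (inj₂ r)) (proj₂ (rowS-iff s t) c)
  Sr : ∀ {s t} → κS s ≡ κS t → T (cS s t)
  Sr {s} {t} e = proj₁ (rowS-iff s t) (cong getS e)

  conn-c₂c₁ : ∀ i j → G'.conn (c₂ i) (c₁ j) ≡ (b2 ∧ P2 i) ∧ ((b0 ∧ P1 j) ∧ cS (suc zero) zero)
  conn-c₂c₁ i j = T-ext to from
    where
    to : T (G'.conn (c₂ i) (c₁ j)) → T ((b2 ∧ P2 i) ∧ ((b0 ∧ P1 j) ∧ cS (suc zero) zero))
    to t with conn-κ _ _ t | T-dec (b2 ∧ P2 i) | T-dec (b0 ∧ P1 j)
    ... | e | inj₁ x | inj₁ y = ∧-i x (∧-i y (Sr (trans (sym (κ2-T i x)) (trans e (κ1-T j y)))))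
    ... | e | inj₁ x | inj₂ y = ⊥-elim (clash (sym (trans (sym (κ2-T i x)) (trans e (κ1-F j y)))))
    ... | e | inj₂ x | inj₁ y = ⊥-elim (clash (cong getR (trans (sym (κ2-F i x)) (trans e (κ1-T j y)))))
    ... | e | inj₂ x | inj₂ y = ⊥-elim (clash (sym (trans (sym (κ2-F i x)) (trans e (κ1-F j y)))))
    from : T ((b2 ∧ P2 i) ∧ ((b0 ∧ P1 j) ∧ cS (suc zero) zero)) → T (G'.conn (c₂ i) (c₁ j))
    from t = κ-conn _ _ (trans (κ2-T i (∧-el t)) (trans (rS (∧-er {b0 ∧ P1 j} (∧-er {b2 ∧ P2 i} t))) (sym (κ1-T j (∧-el (∧-er {b2 ∧ P2 i} t))))))

  conn-new-c₁ : ∀ j i → G'.conn (new j) (c₁ i) ≡ (b0 ∧ P1 i) ∧ cS (ss j) zero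
  conn-new-c₁ j i = T-ext to from
    where
    to : T (G'.conn (new j) (c₁ i)) → T ((b0 ∧ P1 i) ∧ cS (ss j) zero)
    to t with conn-κ _ _ t | T-dec (b0 ∧ P1 i)
    ... | e | inj₁ y = ∧-i y (Sr (trans (sym (κnw j)) (trans e (κ1-T i y))))
    ... | e | inj₂ y = ⊥-elim (clash (sym (trans (sym (κnw j)) (trans e (κ1-F i y)))))
    from : T ((b0 ∧ P1 i) ∧ cS (ss j) zero) → T (G'.conn (new j) (c₁ i))
    from t = κ-conn _ _ (trans (κnw j) (trans (rS (∧-er {b0 ∧ P1 i} t)) (sym (κ1-T i (∧-el t)))))

  conn-new-c₂ : ∀ j i → G'.conn (new j) (c₂ i) ≡ (b2 ∧ P2 i) ∧ cS (ss j) (suc zero)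
  conn-new-c₂ j i = T-ext to from
    where
    to : T (G'.conn (new j) (c₂ i)) → T ((b2 ∧ P2 i) ∧ cS (ss j) (suc zero))
    to t with conn-κ _ _ t | T-dec (b2 ∧ P2 i)
    ... | e | inj₁ y = ∧-i y (Sr (trans (sym (κnw j)) (trans e (κ2-T i y))))
    ... | e | inj₂ y = ⊥-elim (clash (sym (cong getR (trans (sym (κnw j)) (trans e (κ2-F i y))))))
    from : T ((b2 ∧ P2 i) ∧ cS (ss j) (suc zero)) → T (G'.conn (new j) (c₂ i))
    from t = κ-conn _ _ (trans (κnw j) (trans (rS (∧-er {b2 ∧ P2 i} t)) (sym (κ2-T i (∧-el t)))))

  conn-new-new : ∀ j j' → G'.conn (new j) (new j') ≡ cS (ss j) (ss j')
  conn-new-new j j' = T-ext (λ t → Sr (trans (sym (κnw j)) (trans (conn-κ _ _ t) (κnw j'))))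
                    (λ t → κ-conn _ _ (trans (κnw j) (trans (rS t) (sym (κnw j')))))

  drop-middle : ∀ X a p Y → T (X ∧ ((a ∧ p) ∧ Y)) → T (X ∧ (a ∧ Y))
  drop-middle true true true true _ = tt
  add-middle : ∀ X a p Y → T (X ∧ (a ∧ Y)) → T p → T (X ∧ ((a ∧ p) ∧ Y))
  add-middle true true true true _ _ = tt

  anyP1 : ∀ X Y → anyF (λ j → X ∧ ((b0 ∧ P1 j) ∧ Y)) ≡ X ∧ (b0 ∧ Y)
  anyP1 X Y = T-ext
    (λ s → let (j , t) = anyF-elim (λ j → X ∧ ((b0 ∧ P1 j) ∧ Y)) s in drop-middle X b0 (P1 j) Y t)
    (λ s → anyF-intro (λ j → X ∧ ((b0 ∧ P1 j) ∧ Y)) (dang₁ A) (add-middle X b0 (P1 (dang₁ A)) Y s (G1.reach-refl (n A) (dang₁ A))))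
  anyP2 : ∀ X Y → anyF (λ j → X ∧ ((b2 ∧ P2 j) ∧ Y)) ≡ X ∧ (b2 ∧ Y)
  anyP2 X Y = T-ext
    (λ s → let (j , t) = anyF-elim (λ j → X ∧ ((b2 ∧ P2 j) ∧ Y)) s in drop-middle X b2 (P2 j) Y t)
    (λ s → anyF-intro (λ j → X ∧ ((b2 ∧ P2 j) ∧ Y)) (dang₁ A) (add-middle X b2 (P2 (dang₁ A)) Y s (G2.reach-refl (n A) (dang₁ A))))

  ∨ff : ∀ x → ((x ∨ false) ∨ false) ≡ x
  ∨ff true = refl
  ∨ff false = refl

  least-c₁ : ∀ i → G'.least (c₁ i) ≡ G1.least i
  least-c₁ i = cong not (trans (anyV _)
    (trans (cong₂ (λ x y → (x ∨ y) ∨ anyF (λ k → ⌊ new k <? c₁ i ⌋ ∧ G'.conn (c₁ i) (new k)))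
       (anyF-ext (λ j → cong₂ _∧_ (lt-c1c1 j i) (conn-c₁c₁ i j)))
       (anyF-allFalse _ (λ j → cong (_∧ G'.conn (c₁ i) (c₂ j)) (lt-c2c1 j i))))
     (trans (cong (λ y → (anyF (λ j → ⌊ j <? i ⌋ ∧ G1.conn i j) ∨ false) ∨ y)
       (anyF-allFalse _ (λ j → cong (_∧ G'.conn (c₁ i) (new j)) (lt-nwc1 j i))))
       (∨ff _))))

  not-∨-false : ∀ z w → not ((z ∨ w) ∨ false) ≡ (not w ∧ not z)
  not-∨-false true true = refl
  not-∨-false true false = refl
  not-∨-false false true = refl
  not-∨-false false false = refl

  least-c₂ : ∀ i → G'.least (c₂ i) ≡ G2.least i ∧ not ((b2 ∧ P2 i) ∧ (b0 ∧ cS (suc zero) zero))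
  least-c₂ i = trans (cong not (trans (anyV _)
    (trans (cong₂ (λ x y → (x ∨ y) ∨ anyF (λ k → ⌊ new k <? c₂ i ⌋ ∧ G'.conn (c₂ i) (new k)))
       (trans (anyF-ext (λ j → cong₂ _∧_ (lt-c1c2 j i) (conn-c₂c₁ i j))) (anyP1 (b2 ∧ P2 i) (cS (suc zero) zero)))
       (anyF-ext (λ j → cong₂ _∧_ (lt-c2c2 j i) (conn-c₂c₂ i j))))
     (cong (λ y → (((b2 ∧ P2 i) ∧ (b0 ∧ cS (suc zero) zero)) ∨ anyF (λ j → ⌊ j <? i ⌋ ∧ G2.conn i j)) ∨ y)
       (anyF-allFalse _ (λ j → cong (_∧ G'.conn (c₂ i) (new j)) (lt-nwc2 j i)))))))
    (not-∨-false ((b2 ∧ P2 i) ∧ (b0 ∧ cS (suc zero) zero)) (anyF (λ j → ⌊ j <? i ⌋ ∧ G2.conn i j)))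

  LN : Fin 4 → Bool
  LN j = not (((b0 ∧ cS (ss j) zero) ∨ (b2 ∧ cS (ss j) (suc zero))) ∨ anyF (λ j' → ⌊ j' <? j ⌋ ∧ cS (ss j) (ss j')))

  least-new : ∀ j → G'.least (new j) ≡ LN j
  least-new j = cong not (trans (anyV _)
    (cong₂ _∨_ (cong₂ _∨_
       (trans (anyF-ext (λ i → cong₂ _∧_ (lt-c1nw i j) (conn-new-c₁ j i))) (anyP1 true (cS (ss j) zero)))
       (trans (anyF-ext (λ i → cong₂ _∧_ (lt-c2nw i j) (conn-new-c₂ j i))) (anyP2 true (cS (ss j) (suc zero)))))
       (anyF-ext (λ j' → cong₂ _∧_ (lt-nwnw j' j) (conn-new-new j j')))))


excessArith : ∀ E' E1 E2 i1 i2 NI NL cl' cl1 cl2 d c b0 b2 →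
  E' + (i1 + i2 + NI) + d + d ≡ cl' + cl' → E1 + i1 + b0 + b0 ≡ cl1 + cl1 → E2 + i2 + b2 + b2 ≡ cl2 + cl2 →
  cl' + c ≡ cl1 + cl2 + NL →
  E' + NI + d + d + c + c ≡ E1 + E2 + b0 + b0 + b2 + b2 + NL + NL
excessArith E' E1 E2 i1 i2 NI NL cl' cl1 cl2 d c b0 b2 h' h1 h2 hc = +-cancelʳ-≡ (i1 + i2) _ _ (begin
    E' + NI + d + d + c + c + (i1 + i2)
      ≡⟨ solve 6 (λ E' NI d c i1 i2 → E' :+ NI :+ d :+ d :+ c :+ c :+ (i1 :+ i2) := E' :+ (i1 :+ i2 :+ NI) :+ d :+ d :+ c :+ c) refl E' NI d c i1 i2 ⟩
    E' + (i1 + i2 + NI) + d + d + c + c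
      ≡⟨ cong (λ z → z + c + c) h' ⟩
    cl' + cl' + c + c
      ≡⟨ solve 2 (λ x c → x :+ x :+ c :+ c := (x :+ c) :+ (x :+ c)) refl cl' c ⟩
    (cl' + c) + (cl' + c)
      ≡⟨ cong₂ _+_ hc hc ⟩
    (cl1 + cl2 + NL) + (cl1 + cl2 + NL)
      ≡⟨ solve 3 (λ a b n → (a :+ b :+ n) :+ (a :+ b :+ n) := (a :+ a) :+ (b :+ b) :+ n :+ n) refl cl1 cl2 NL ⟩
    (cl1 + cl1) + (cl2 + cl2) + NL + NL
      ≡⟨ cong (λ z → z + NL + NL) (sym (cong₂ _+_ h1 h2)) ⟩
    (E1 + i1 + b0 + b0) + (E2 + i2 + b2 + b2) + NL + NL
      ≡⟨ solve 7 (λ E1 E2 i1 i2 b0 b2 NL → (E1 :+ i1 :+ b0 :+ b0) :+ (E2 :+ i2 :+ b2 :+ b2) :+ NL :+ NL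
                 := E1 :+ E2 :+ b0 :+ b0 :+ b2 :+ b2 :+ NL :+ NL :+ (i1 :+ i2)) refl E1 E2 i1 i2 b0 b2 NL ⟩
    E1 + E2 + b0 + b0 + b2 + b2 + NL + NL + (i1 + i2) ∎)
  where open ≡-Reasoning

tabN1f : (b4 b5 b6 : Bool) → Fin 4 → Fin 7 → Bool
tabN1f b4 b5 b6 j (suc (suc (suc (suc zero)))) = b4 ∧ (zero == j)
tabN1f b4 b5 b6 j (suc (suc (suc (suc (suc zero))))) = b5 ∧ (suc (suc zero) == j)
tabN1f b4 b5 b6 j (suc (suc (suc (suc (suc (suc zero)))))) = b6 ∧ (suc (suc (suc zero)) == j)
tabN1f b4 b5 b6 j _ = false

tabN2f : (b0 b1 b2 b3 b4 b5 b6 : Bool) → Fin 4 → Fin 7 → Bool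
tabN2f b0 b1 b2 b3 b4 b5 b6 j zero = b0 ∧ (zero == j)
tabN2f b0 b1 b2 b3 b4 b5 b6 j (suc zero) = b1 ∧ (suc zero == j)
tabN2f b0 b1 b2 b3 b4 b5 b6 j (suc (suc zero)) = b2 ∧ (zero == j)
tabN2f b0 b1 b2 b3 b4 b5 b6 j (suc (suc (suc zero))) = b3 ∧ (suc zero == j)
tabN2f b0 b1 b2 b3 b4 b5 b6 j (suc (suc (suc (suc zero)))) = b4 ∧ (suc (suc zero) == j)
tabN2f b0 b1 b2 b3 b4 b5 b6 j (suc (suc (suc (suc (suc zero))))) = b5 ∧ (suc (suc (suc zero)) == j)
tabN2f b0 b1 b2 b3 b4 b5 b6 j (suc (suc (suc (suc (suc (suc zero)))))) = b6 ∧ (suc zero == j)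

degNf : (b0 b1 b2 b3 b4 b5 b6 d : Bool) → Fin 4 → ℕ
degNf b0 b1 b2 b3 b4 b5 b6 d j = countF (tabN1f b4 b5 b6 j) + countF (tabN2f b0 b1 b2 b3 b4 b5 b6 j)
   + (if d then [ suc (suc zero) == j ] + [ suc (suc (suc zero)) == j ] else 0)

-- bounded reachability with the adjacency tested first (faster evaluation)
reachA : ∀ {k} (adj : Fin k → Fin k → Bool) → ℕ → Fin k → Fin k → Bool
reachA adj zero u w = u == w
reachA adj (suc j) u w = reachA adj j u w ∨ anyF (λ x → adj x w ∧ reachA adj j u x)

reachA≡ : ∀ {k} (adj : Fin k → Fin k → Bool) j u w → reachA adj j u w ≡ Graph.reach adj j u w
reachA≡ adj zero u w = refl
reachA≡ adj (suc j) u w = cong₂ _∨_ (reachA≡ adj j u w)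
  (anyF-ext (λ x → trans (∧-comm (adj x w) _) (cong (_∧ adj x w) (reachA≡ adj j u x))))

evB : ℕ → Bool
evB zero = true
evB (suc (suc zero)) = true
evB _ = false

okf : (b0 b2 b4 b5 b6 d : Bool) → Bool
okf b0 b2 b4 b5 b6 d = evB (degNf b0 b0 b2 b2 b4 b5 b6 d zero) ∧ evB (degNf b0 b0 b2 b2 b4 b5 b6 d (suc zero))
  ∧ evB (degNf b0 b0 b2 b2 b4 b5 b6 d (suc (suc zero))) ∧ evB (degNf b0 b0 b2 b2 b4 b5 b6 d (suc (suc (suc zero))))

NIf : (b0 b2 b4 b5 b6 d : Bool) → ℕ
NIf b0 b2 b4 b5 b6 d = countF (λ j → isZero (degNf b0 b0 b2 b2 b4 b5 b6 d j))

-- the target bound 2a + tgt d, and the hypothesis bound a + Lb b on A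
tgt : Bool → ℕ
tgt d = if d then 2 else 4
Lb : Bool → ℕ
Lb b = if b then 0 else 2

-- The correction terms of the excess identity as functions of the parameters:
-- excess F' + lhsK = excess F1 + excess F2 + rhsK.  They are abstract so that
-- they are evaluated only in `finiteCheck` and at the witnesses; elsewhere the
-- `-def` lemmas unfold them.
abstract
  cSc : (b0 b2 b4 b5 b6 : Bool) → Fin 6 → Fin 6 → Bool
  cSc b0 b2 b4 b5 b6 = reachA (supAdj b0 b2 b4 b5 b6) 6

  LNf : (b0 b2 b4 b5 b6 : Bool) → Fin 4 → Bool
  LNf b0 b2 b4 b5 b6 j = not (((b0 ∧ cSc b0 b2 b4 b5 b6 (suc (suc j)) zero) ∨ (b2 ∧ cSc b0 b2 b4 b5 b6 (suc (suc j)) (suc zero)))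
     ∨ anyF (λ j' → ⌊ j' <? j ⌋ ∧ cSc b0 b2 b4 b5 b6 (suc (suc j)) (suc (suc j'))))

  NLf : (b0 b2 b4 b5 b6 : Bool) → ℕ
  NLf b0 b2 b4 b5 b6 = countF (LNf b0 b2 b4 b5 b6)

  ccf : (b0 b2 b4 b5 b6 : Bool) → Bool
  ccf b0 b2 b4 b5 b6 = b2 ∧ (b0 ∧ cSc b0 b2 b4 b5 b6 (suc zero) zero)

  lhsK : (b0 b2 b4 b5 b6 d : Bool) → ℕ
  lhsK b0 b2 b4 b5 b6 d = NIf b0 b2 b4 b5 b6 d + [ d ] + [ d ] + [ ccf b0 b2 b4 b5 b6 ] + [ ccf b0 b2 b4 b5 b6 ]
  rhsK : (b0 b2 b4 b5 b6 : Bool) → ℕ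
  rhsK b0 b2 b4 b5 b6 = [ b0 ] + [ b0 ] + [ b2 ] + [ b2 ] + NLf b0 b2 b4 b5 b6 + NLf b0 b2 b4 b5 b6

  -- the bound holds in all 64 cases of the parameters, checked by evaluation
  finiteCheck : ∀ b0 b2 b4 b5 b6 d → T (okf b0 b2 b4 b5 b6 d) →
    tgt d + lhsK b0 b2 b4 b5 b6 d ≤ Lb b0 + Lb b2 + rhsK b0 b2 b4 b5 b6
  finiteCheck b0 b2 b4 b5 b6 d ok
    with ∨-e {not (okf b0 b2 b4 b5 b6 d)} (allVec-sound 6 check tt (b0 ∷ b2 ∷ b4 ∷ b5 ∷ b6 ∷ d ∷ []))
    where
    check : Vec Bool 6 → Bool
    check (b0 ∷ b2 ∷ b4 ∷ b5 ∷ b6 ∷ d ∷ []) =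
      not (okf b0 b2 b4 b5 b6 d) ∨ ((tgt d + lhsK b0 b2 b4 b5 b6 d) ≤ᵇ (Lb b0 + Lb b2 + rhsK b0 b2 b4 b5 b6))
  ... | inj₁ notOk = ⊥-elim (T-not notOk ok)
  ... | inj₂ le = ≤ᵇ⇒≤ _ _ le

  LNf-def : ∀ b0 b2 b4 b5 b6 j → LNf b0 b2 b4 b5 b6 j ≡ not (((b0 ∧ cSc b0 b2 b4 b5 b6 (suc (suc j)) zero) ∨ (b2 ∧ cSc b0 b2 b4 b5 b6 (suc (suc j)) (suc zero)))
     ∨ anyF (λ j' → ⌊ j' <? j ⌋ ∧ cSc b0 b2 b4 b5 b6 (suc (suc j)) (suc (suc j'))))
  LNf-def b0 b2 b4 b5 b6 j = refl
  NLf-def : ∀ b0 b2 b4 b5 b6 → NLf b0 b2 b4 b5 b6 ≡ countF (LNf b0 b2 b4 b5 b6)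
  NLf-def b0 b2 b4 b5 b6 = refl
  ccf-def : ∀ b0 b2 b4 b5 b6 → ccf b0 b2 b4 b5 b6 ≡ b2 ∧ (b0 ∧ cSc b0 b2 b4 b5 b6 (suc zero) zero)
  ccf-def b0 b2 b4 b5 b6 = refl
  cSc-def : ∀ b0 b2 b4 b5 b6 s t → cSc b0 b2 b4 b5 b6 s t ≡ reachA (supAdj b0 b2 b4 b5 b6) 6 s t
  cSc-def b0 b2 b4 b5 b6 s t = refl
  lhsK-def : ∀ b0 b2 b4 b5 b6 d → lhsK b0 b2 b4 b5 b6 d ≡ NIf b0 b2 b4 b5 b6 d + [ d ] + [ d ] + [ ccf b0 b2 b4 b5 b6 ] + [ ccf b0 b2 b4 b5 b6 ]
  lhsK-def b0 b2 b4 b5 b6 d = refl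
  rhsK-def : ∀ b0 b2 b4 b5 b6 → rhsK b0 b2 b4 b5 b6 ≡ [ b0 ] + [ b0 ] + [ b2 ] + [ b2 ] + NLf b0 b2 b4 b5 b6 + NLf b0 b2 b4 b5 b6
  rhsK-def b0 b2 b4 b5 b6 = refl
  lhsK-closed : lhsK true false true true true false ≡ 0
  lhsK-closed = refl
  rhsK-closed : rhsK true false true true true ≡ 2
  rhsK-closed = refl
  lhsK-open : lhsK true false true false true true ≡ 2
  lhsK-open = refl
  rhsK-open : rhsK true false true false true ≡ 2
  rhsK-open = refl


evB-of : ∀ {x} → x ≡ 0 ⊎ x ≡ 2 → T (evB x)
evB-of (inj₁ refl) = tt
evB-of (inj₂ refl) = tt

boundArith : ∀ a t E' E1 E2 K1 K2 L0 L2 → E' + K1 ≡ E1 + E2 + K2 → t + K1 ≤ L0 + L2 + K2 →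
  a + L0 ≤ E1 → a + L2 ≤ E2 → a + a + t ≤ E'
boundArith a t E' E1 E2 K1 K2 L0 L2 h c l1 l2 = +-cancelʳ-≤ K1 (a + a + t) E' (begin
    a + a + t + K1 ≡⟨ solve 3 (λ a t k → a :+ a :+ t :+ k := a :+ a :+ (t :+ k)) refl a t K1 ⟩
    a + a + (t + K1) ≤⟨ +-mono-≤ (≤-refl {a + a}) c ⟩
    a + a + (L0 + L2 + K2) ≡⟨ solve 4 (λ a x y k → a :+ a :+ (x :+ y :+ k) := (a :+ x) :+ (a :+ y) :+ k) refl a L0 L2 K2 ⟩
    (a + L0) + (a + L2) + K2 ≤⟨ +-monoˡ-≤ K2 (+-mono-≤ l1 l2) ⟩
    E1 + E2 + K2 ≡⟨ sym h ⟩
    E' + K1 ∎)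
  where open ≤-Reasoning

reassocL : ∀ E n d c → E + (n + d + d + c + c) ≡ E + n + d + d + c + c
reassocL = solve 4 (λ E n d c → E :+ (n :+ d :+ d :+ c :+ c) := E :+ n :+ d :+ d :+ c :+ c) refl
reassocR : ∀ E1 E2 x y n → E1 + E2 + x + x + y + y + n + n ≡ E1 + E2 + (x + x + y + y + n + n)
reassocR = solve 5 (λ E1 E2 x y n → E1 :+ E2 :+ x :+ x :+ y :+ y :+ n :+ n := E1 :+ E2 :+ (x :+ x :+ y :+ y :+ n :+ n)) refl

module ExcessBound (A : Pole) (f₁ f₂ : Bool) (F' : Factor (doubled A f₁ f₂)) (ev : IsEven (doubled A f₁ f₂) F') where
  open Components A f₁ f₂ F' ev public

  -- copy 1's path and copy 2's path lie in one component of F'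
  cc : Bool
  cc = b0 ∧ cS (suc zero) zero

  -- components of F' made only of new vertices, and uncovered new vertices
  NL : ℕ
  NL = countF LN

  NI : ℕ
  NI = countF (λ j → isZero (degN j))

  -- copy 2 loses its path component exactly when it is glued to copy 1's
  classes2Split : countF (λ i → G2.least i ∧ not ((b2 ∧ P2 i) ∧ cc)) + [ b2 ∧ cc ] ≡ G2.classes
  classes2Split = trans (+-comm _ [ b2 ∧ cc ]) (sym (trans (countF-part G2.least (λ i → (b2 ∧ P2 i) ∧ cc))
     (cong (_+ countF (λ i → G2.least i ∧ not ((b2 ∧ P2 i) ∧ cc)))
       (trans (countF-ext (λ i → ∧-shuffle (G2.least i) b2 (P2 i) cc))
       (trans (sym (ifCount (b2 ∧ cc) (λ i → P2 i ∧ G2.least i)))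
         (cong (λ z → if b2 ∧ cc then z else 0) (G2.leastInClass (dang₁ A))))))))

  classesIdentity : G'.classes + [ b2 ∧ cc ] ≡ G1.classes + G2.classes + NL
  classesIdentity = trans (cong (_+ [ b2 ∧ cc ]) (trans (countV G'.least)
            (cong₂ _+_ (cong₂ _+_ (countF-ext least-c₁) (countF-ext least-c₂)) (countF-ext least-new))))
         (trans (solve 4 (λ a s n x → a :+ s :+ n :+ x := a :+ (s :+ x) :+ n) refl G1.classes _ NL [ b2 ∧ cc ])
           (cong (λ z → G1.classes + z + NL) classes2Split))

  isolatedSplit : isolated A' F' ≡ isolated A F1 + isolated A F2 + NI
  isolatedSplit = trans (countV (uncovered A' F'))
    (cong₂ _+_ (cong₂ _+_ (countF-ext (λ i → cong isZero (deg1 pb1 i))) (countF-ext (λ i → cong isZero (deg2 pb3 i))))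
               (countF-ext (λ j → cong isZero (deg-new j))))

  excessIdentity : excess A' F' + NI + [ d ] + [ d ] + [ b2 ∧ cc ] + [ b2 ∧ cc ] ≡
           excess A F1 + excess A F2 + [ b0 ] + [ b0 ] + [ b2 ] + [ b2 ] + NL + NL
  excessIdentity = excessArith (excess A' F') (excess A F1) (excess A F2) (isolated A F1) (isolated A F2) NI NL
    G'.classes G1.classes G2.classes [ d ] [ b2 ∧ cc ] [ b0 ] [ b2 ]
    (subst (λ z → excess A' F' + z + [ d ] + [ d ] ≡ G'.classes + G'.classes) isolatedSplit (excessEq A' F'))
    (excessEq A F1) (excessEq A F2) classesIdentity


  degN≡ : ∀ j → degN j ≡ degNf b0 b0 b2 b2 b4 b5 b6 d j
  degN≡ j = trans (refl {x = degNf b0 b1 b2 b3 b4 b5 b6 d j})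
     (cong₂ (λ y z → degNf b0 y b2 z b4 b5 b6 d j) pb1 pb3)

  NI≡ : NI ≡ NIf b0 b2 b4 b5 b6 d
  NI≡ = countF-ext (λ j → cong isZero (degN≡ j))

  cS≡ : ∀ s t → cS s t ≡ cSc b0 b2 b4 b5 b6 s t
  cS≡ s t = trans (connS-def b0 b2 b4 b5 b6 s t) (trans (sym (reachA≡ (supAdj b0 b2 b4 b5 b6) 6 s t)) (sym (cSc-def b0 b2 b4 b5 b6 s t)))

  NL≡ : NL ≡ NLf b0 b2 b4 b5 b6
  NL≡ = trans (countF-ext (λ j → trans (cong not (cong₂ _∨_ (cong₂ _∨_ (cong (b0 ∧_) (cS≡ (ss j) zero)) (cong (b2 ∧_) (cS≡ (ss j) (suc zero))))
           (anyF-ext (λ j' → cong (⌊ j' <? j ⌋ ∧_) (cS≡ (ss j) (ss j')))))) (sym (LNf-def b0 b2 b4 b5 b6 j))))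
           (sym (NLf-def b0 b2 b4 b5 b6))

  cc≡ : (b2 ∧ cc) ≡ ccf b0 b2 b4 b5 b6
  cc≡ = trans (cong (λ z → b2 ∧ (b0 ∧ z)) (cS≡ (suc zero) zero)) (sym (ccf-def b0 b2 b4 b5 b6))

  excessIdentityClosed : excess A' F' + lhsK b0 b2 b4 b5 b6 d ≡ excess A F1 + excess A F2 + rhsK b0 b2 b4 b5 b6
  excessIdentityClosed = trans (cong (excess A' F' +_) (lhsK-def b0 b2 b4 b5 b6 d)) (trans (reassocL (excess A' F') (NIf b0 b2 b4 b5 b6 d) [ d ] [ ccf b0 b2 b4 b5 b6 ])
    (trans (subst₂ (λ x y → excess A' F' + NIf b0 b2 b4 b5 b6 d + [ d ] + [ d ] + [ x ] + [ x ] ≡ excess A F1 + excess A F2 + [ b0 ] + [ b0 ] + [ b2 ] + [ b2 ] + y + y)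
             cc≡ NL≡ (subst (λ z → excess A' F' + z + [ d ] + [ d ] + [ b2 ∧ cc ] + [ b2 ∧ cc ] ≡ excess A F1 + excess A F2 + [ b0 ] + [ b0 ] + [ b2 ] + [ b2 ] + NL + NL) NI≡ excessIdentity))
      (trans (reassocR (excess A F1) (excess A F2) [ b0 ] [ b2 ] (NLf b0 b2 b4 b5 b6)) (cong (excess A F1 + excess A F2 +_) (sym (rhsK-def b0 b2 b4 b5 b6))))))

  newDegreesOk : T (okf b0 b2 b4 b5 b6 d)
  newDegreesOk = ∧-i (e zero) (∧-i (e (suc zero)) (∧-i (e (suc (suc zero))) (e (suc (suc (suc zero))))))
    where e : ∀ j → T (evB (degNf b0 b0 b2 b2 b4 b5 b6 d j))
          e j = evB-of (subst (λ z → z ≡ 0 ⊎ z ≡ 2) (trans (deg-new j) (degN≡ j)) (ev (new j)))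

  lowerBound : (a : ℕ) → (∀ F → IsEven A F → a + Lb (withD F) ≤ excess A F) → a + a + tgt d ≤ excess A' F'
  lowerBound a hyp = boundArith a (tgt d) (excess A' F') (excess A F1) (excess A F2) (lhsK b0 b2 b4 b5 b6 d) (rhsK b0 b2 b4 b5 b6)
     (Lb b0) (Lb b2) excessIdentityClosed (finiteCheck b0 b2 b4 b5 b6 d newDegreesOk) (hyp F1 ev1) (hyp F2 ev2)


witnessEdges : Bool → Fin 7 → Bool
witnessEdges b5v zero = true
witnessEdges b5v (suc zero) = true
witnessEdges b5v (suc (suc zero)) = false
witnessEdges b5v (suc (suc (suc zero))) = false
witnessEdges b5v (suc (suc (suc (suc zero)))) = true
witnessEdges b5v (suc (suc (suc (suc (suc zero))))) = b5v
witnessEdges b5v (suc (suc (suc (suc (suc (suc zero)))))) = true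

glue : (A : Pole) (f₁ f₂ : Bool) → Factor A → Factor A → (Fin 7 → Bool) → Bool → Factor (doubled A f₁ f₂)
glue A f₁ f₂ G H tb dd = record
  { inF = λ e → [ (λ y → [ inF G , inF H ]′ (splitAt (m A) y)) , tb ]′ (splitAt (m A + m A) e)
  ; withD = dd }

degNf-cong : ∀ {x0 x1 x2 x3 x4 x5 x6 y0 y1 y2 y3 y4 y5 y6 : Bool} d j → x0 ≡ y0 → x1 ≡ y1 → x2 ≡ y2 → x3 ≡ y3 → x4 ≡ y4 → x5 ≡ y5 → x6 ≡ y6 →
  degNf x0 x1 x2 x3 x4 x5 x6 d j ≡ degNf y0 y1 y2 y3 y4 y5 y6 d j
degNf-cong d j refl refl refl refl refl refl refl = refl

lhsK-cong : ∀ {x0 x2 x4 x5 x6 y0 y2 y4 y5 y6 : Bool} d → x0 ≡ y0 → x2 ≡ y2 → x4 ≡ y4 → x5 ≡ y5 → x6 ≡ y6 →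
  lhsK x0 x2 x4 x5 x6 d ≡ lhsK y0 y2 y4 y5 y6 d
lhsK-cong d refl refl refl refl refl = refl

rhsK-cong : ∀ {x0 x2 x4 x5 x6 y0 y2 y4 y5 y6 : Bool} → x0 ≡ y0 → x2 ≡ y2 → x4 ≡ y4 → x5 ≡ y5 → x6 ≡ y6 →
  rhsK x0 x2 x4 x5 x6 ≡ rhsK y0 y2 y4 y5 y6
rhsK-cong refl refl refl refl refl = refl

module Witness (A : Pole) (f₁ f₂ : Bool) (G H : Factor A) (evG : IsEven A G) (evH : IsEven A H)
          (wG : withD G ≡ true) (wH : withD H ≡ false) (b5v dd : Bool)
          (okN : ∀ j → degNf true true false false true b5v true dd j ≡ 0 ⊎ degNf true true false false true b5v true dd j ≡ 2) where
  F' : Factor (doubled A f₁ f₂)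
  F' = glue A f₁ f₂ G H (witnessEdges b5v) dd
  open Restriction A f₁ f₂ F' public

  bk : ∀ k → b k ≡ witnessEdges b5v k
  bk k rewrite FP.splitAt-↑ʳ (m A + m A) 7 k = refl

  i1 : ∀ e → inF F1 e ≡ inF G e
  i1 e rewrite FP.splitAt-↑ˡ (m A + m A) (e ↑ˡ m A) 7 | FP.splitAt-↑ˡ (m A) e (m A) = refl
  i2 : ∀ e → inF F2 e ≡ inF H e
  i2 e rewrite FP.splitAt-↑ˡ (m A + m A) (m A ↑ʳ e) 7 | FP.splitAt-↑ʳ (m A) (m A) e = refl

  w1 : withD F1 ≡ withD G
  w1 = trans (bk zero) (sym wG)
  w2 : withD F2 ≡ withD H
  w2 = trans (bk (suc (suc zero))) (sym wH)

  ex1 : excess A F1 ≡ excess A G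
  ex1 = FactorExt.excessE A F1 G i1 w1
  ex2 : excess A F2 ≡ excess A H
  ex2 = FactorExt.excessE A F2 H i2 w2
  ev1' : IsEven A F1
  ev1' = FactorExt.evenE A G F1 (λ e → sym (i1 e)) (sym w1) evG
  ev2' : IsEven A F2
  ev2' = FactorExt.evenE A H F2 (λ e → sym (i2 e)) (sym w2) evH

  pb1' : b1 ≡ b0
  pb1' = trans (bk (suc zero)) (sym (bk zero))
  pb3' : b3 ≡ b2
  pb3' = trans (bk (suc (suc (suc zero)))) (sym (bk (suc (suc zero))))

  degNeq : ∀ j → degN j ≡ degNf true true false false true b5v true dd j
  degNeq j = degNf-cong d j (bk zero) (bk (suc zero)) (bk (suc (suc zero))) (bk (suc (suc (suc zero))))
     (bk (suc (suc (suc (suc zero))))) (bk (suc (suc (suc (suc (suc zero)))))) (bk (suc (suc (suc (suc (suc (suc zero)))))))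

  evF' : IsEven A' F'
  evF' v = go v (view3 (n A) 4 v)
    where
    go : ∀ v → View3 {n A} {4} v → degF A' F' v ≡ 0 ⊎ degF A' F' v ≡ 2
    go _ (v1 i) = subst (λ z → z ≡ 0 ⊎ z ≡ 2) (sym (deg1 pb1' i)) (ev1' i)
    go _ (v2 i) = subst (λ z → z ≡ 0 ⊎ z ≡ 2) (sym (deg2 pb3' i)) (ev2' i)
    go _ (v3 j) = subst (λ z → z ≡ 0 ⊎ z ≡ 2) (sym (trans (deg-new j) (degNeq j))) (okN j)

  witnessIdentity : excess A' F' + lhsK true false true b5v true dd ≡ excess A G + excess A H + rhsK true false true b5v true
  witnessIdentity = subst₂ (λ x y → excess A' F' + x ≡ excess A G + excess A H + y)
          (lhsK-cong dd (bk zero) (bk (suc (suc zero))) (bk (suc (suc (suc (suc zero))))) (bk (suc (suc (suc (suc (suc zero)))))) (bk (suc (suc (suc (suc (suc (suc zero))))))))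
          (rhsK-cong (bk zero) (bk (suc (suc zero))) (bk (suc (suc (suc (suc zero))))) (bk (suc (suc (suc (suc (suc zero)))))) (bk (suc (suc (suc (suc (suc (suc zero))))))))
          (subst₂ (λ x y → excess A' F' + lhsK b0 b2 b4 b5 b6 d ≡ x + y + rhsK b0 b2 b4 b5 b6) ex1 ex2 (ExcessBound.excessIdentityClosed A f₁ f₂ F' evF'))


closedDegrees : ∀ j → degNf true true false false true true true false j ≡ 0 ⊎ degNf true true false false true true true false j ≡ 2
closedDegrees zero = inj₂ refl
closedDegrees (suc zero) = inj₂ refl
closedDegrees (suc (suc zero)) = inj₂ refl
closedDegrees (suc (suc (suc zero))) = inj₂ refl

openDegrees : ∀ j → degNf true true false false true false true true j ≡ 0 ⊎ degNf true true false false true false true true j ≡ 2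
openDegrees zero = inj₂ refl
openDegrees (suc zero) = inj₂ refl
openDegrees (suc (suc zero)) = inj₂ refl
openDegrees (suc (suc (suc zero))) = inj₂ refl

-- Closed witness: copy 1's dangling path is closed into a circuit by
-- x₁ y₁ y₂ x₂; only this new circuit is added, so the excess grows by 2.
closedWitness : (A : Pole) (f₁ f₂ : Bool) (G H : Factor A) → IsEven A G → IsEven A H →
  withD G ≡ true → withD H ≡ false →
  Σ (Factor (doubled A f₁ f₂)) λ F' → IsEven (doubled A f₁ f₂) F' × withD F' ≡ false ×
    excess (doubled A f₁ f₂) F' ≡ excess A G + excess A H + 2
closedWitness A f₁ f₂ G H evG evH wG wH = F' , evF' , refl , (begin
    excess A' F'                                                  ≡⟨ sym (+-identityʳ _) ⟩
    excess A' F' + 0                                              ≡⟨ cong (excess A' F' +_) (sym lhsK-closed) ⟩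
    excess A' F' + lhsK true false true true true false           ≡⟨ witnessIdentity ⟩
    excess A G + excess A H + rhsK true false true true true      ≡⟨ cong (excess A G + excess A H +_) rhsK-closed ⟩
    excess A G + excess A H + 2                                   ∎)
  where
  open Witness A f₁ f₂ G H evG evH wG wH true false closedDegrees
  open ≡-Reasoning

-- Open witness: the path of A' runs y₁ x₁ (copy 1) x₂ y₂; no circuit is added.
openWitness : (A : Pole) (f₁ f₂ : Bool) (G H : Factor A) → IsEven A G → IsEven A H →
  withD G ≡ true → withD H ≡ false →
  Σ (Factor (doubled A f₁ f₂)) λ F' → IsEven (doubled A f₁ f₂) F' × withD F' ≡ true ×
    excess (doubled A f₁ f₂) F' ≡ excess A G + excess A H
openWitness A f₁ f₂ G H evG evH wG wH = F' , evF' , refl , +-cancelʳ-≡ 2 _ _ (begin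
    excess A' F' + 2                                              ≡⟨ cong (excess A' F' +_) (sym lhsK-open) ⟩
    excess A' F' + lhsK true false true false true true           ≡⟨ witnessIdentity ⟩
    excess A G + excess A H + rhsK true false true false true     ≡⟨ cong (excess A G + excess A H +_) rhsK-open ⟩
    excess A G + excess A H + 2                                   ∎)
  where
  open Witness A f₁ f₂ G H evG evH wG wH false true openDegrees
  open ≡-Reasoning

baseBound : (A : Pole) (a : ℕ) → IsMinExcess A false (a + 2) → IsMinExcess A true a →
  ∀ F → IsEven A F → a + Lb (withD F) ≤ excess A F
baseBound A a (_ , minNoDangling) (_ , minDangling) F ev = byFlag (withD F) refl
  where
  byFlag : ∀ c → withD F ≡ c → a + Lb c ≤ excess A F
  byFlag false w = minNoDangling F ev w
  byFlag true  w = subst (_≤ excess A F) (sym (+-identityʳ a)) (minDangling F ev w)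

lemma1 : (A : Pole) → Is2Pole A → (a N : ℕ) → HasTriple A (a + 2) a N →
    (flip₁ flip₂ : Bool) →
    HasTriple (doubled A flip₁ flip₂) (2 * a + 4) (2 * a + 2) (2 * N + 4)
lemma1 A _ a N (q₀A@((H , evH , wH , eH) , _) , q₂A@((G , evG , wG , eG) , _) , nA) f₁ f₂ =
    (attained (closedWitness A f₁ f₂ G H evG evH wG wH)
       (trans (cong₂ (λ x y → x + y + 2) eG eH) (solve 1 (λ a → a :+ (a :+ con 2) :+ con 2 := con 2 :* a :+ con 4) refl a))
      , bound false (solve 1 (λ a → a :+ a :+ con 4 := con 2 :* a :+ con 4) refl a))
  , (attained (openWitness A f₁ f₂ G H evG evH wG wH)
       (trans (cong₂ _+_ eG eH) (solve 1 (λ a → a :+ (a :+ con 2) := con 2 :* a :+ con 2) refl a))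
      , bound true (solve 1 (λ a → a :+ a :+ con 2 := con 2 :* a :+ con 2) refl a))
  , trans (cong (λ k → k + k + 4) nA) (solve 1 (λ k → k :+ k :+ con 4 := con 2 :* k :+ con 4) refl N)
  where
  A' : Pole
  A' = doubled A f₁ f₂

  attained : ∀ {b e k} → (Σ (Factor A') λ F' → IsEven A' F' × withD F' ≡ b × excess A' F' ≡ e) → e ≡ k →
    Σ (Factor A') λ F' → IsEven A' F' × withD F' ≡ b × excess A' F' ≡ k
  attained (F' , ev , w , ex) eq = F' , ev , w , trans ex eq

  bound : ∀ b {k} → a + a + tgt b ≡ k → ∀ F' → IsEven A' F' → withD F' ≡ b → k ≤ excess A' F'
  bound b eq F' ev refl = subst (_≤ excess A' F') eq (ExcessBound.lowerBound A f₁ f₂ F' ev a (baseBound A a q₀A q₂A))
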